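{- Let $h\in\mathcal H$ be a unit vector, $L=L(h)$, and $k_1,\dots,k_n\in\{*,0,1,2,\dots\}$. Then $K_n(L^{k_1},L^{k_2},\dots,L^{k_n})=0$ unless $k_1=\dots=k_{n-1}=*$ and $k_n=n-1$. In the latter case $$K_n(L^*,\dots,L^*,L^{n-1})=\rho\big((L^*)^{n-1}L^{n-1}\big)=\sum_{\pi\in\Pi^{(2)}_{2n-2}}K_\pi(\underbrace{L^*,\dots,L^*}_{n-1},\underbrace{L,\dots,L}_{n-1})=\sum_{\sigma\in\mathfrak S_{n-1}}\mathbf t(\pi_\sigma),$$ where $\pi_\sigma\in\Pi^{(2)}_{2n-2}$ is the pair partition with pairs $\{i,\,n-1+\sigma(i)\}$, $i=1,\dots,n-1$.
   Context: $\mathcal{C}(\mathcal{H})$ is the unital $*$-algebra generated by $L(\xi),L^*(\xi)$ ($\xi\in\mathcal H$, complex Hilbert space), linear in $\xi$, $L^*(\xi)=L(\xi)^*$. A Fock state is a state $\rho$ with $\rho(L^*(\xi)L^*(\eta))=\rho(L(\xi)L^*(\eta))=\rho(L(\xi)L(\eta))=0$, $\rho(L^*(\xi)L(\eta))=\langle\xi,\eta\rangle$, invariant under $L^\epsilon(\xi)\mapsto L^\epsilon(U\xi)$ for unitaries $U$. Every Fock state $\rho$ has the form $\rho(L^{\epsilon_1}(\zeta_1)\cdots L^{\epsilon_n}(\zeta_n))=\sum_{\pi\in\Pi_n^{(2)}}\mathbf t(\pi)\prod_{\{k<l\}\in\pi}Q(\epsilon_k,\epsilon_l)\langle\zeta_k,\zeta_l\rangle$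 for a function $\mathbf t$ on pair partitions, where $Q(*,1)=1$ and $Q=0$ otherwise, $\epsilon_j\in\{*,1\}$, $L^1=L$. Let $\mathcal{K}=\bigoplus_{i\in\mathbb N}\mathcal{H}_i$ with unitaries $u_i:\mathcal H\to\mathcal H_i$, $\rho$ a Fock state on $\mathcal{C}(\mathcal{K})$ with function $\mathbf t$, and $X^{(k)}$ the image of $X\in\mathcal C(\mathcal H)$ under the $*$-homomorphism $L(\xi)\mapsto L(u_k\xi)$; $\rho(X):=\rho(X^{(1)})$ for $X\in\mathcal C(\mathcal H)$. For $\pi\in\Pi_n$ (set partitions of $[n]$ viewed as maps to block numbers) $\rho_\pi(X_1,\dots,X_n)=\rho(X_1^{(\pi(1))}\cdots X_n^{(\pi(n))})$ and $K_\pi=\sum_{\sigma\le\pi}\rho_\sigma\,\mu(\sigma,\pi)$ with $\mu$ the Möbius function of the refinement order; $K_n=K_{\hat1_n}$. Here $L^*$ denotes $L(h)^*$, $L^0=I$, $L^k$ is the $k$-th power. -}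

module Defs where

open import Level using (Level)
open import Data.Bool using (Bool; true; false; _∧_; _∨_; not; if_then_else_)
open import Data.Nat using (ℕ; zero; suc; _⊔_; _≡ᵇ_)
open import Data.Product using (_×_; _,_; proj₁; proj₂)
open import Data.List using (List; []; _∷_; _++_; map; concatMap; filter; length; replicate; foldr; upTo; zip)
open import Data.Vec as Vec using (Vec)
open import Algebra.Bundles using (CommutativeRing)

-- Letters: L^* (star) and L (one); all vectors equal the unit vector h.

data Eps : Set where
  star one : Eps

data Pow : Set where
  pstar : Pow
  pw    : ℕ → Pow

-- the word in L, L^* represented by L^k  (L^0 = I is the empty word)
word : Pow → List Eps
word pstar  = star ∷ []
word (pw k) = replicate k one

allB : {A : Set} → (A → Bool) → List A → Bool
allB p = foldr (λ x b → p x ∧ b) true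

anyB : {A : Set} → (A → Bool) → List A → Bool
anyB p = foldr (λ x b → p x ∨ b) false

countB : {A : Set} → (A → Bool) → List A → ℕ
countB p = foldr (λ x n → if p x then suc n else n) 0

-- Set partitions of [n] as canonical block-label maps
-- (restricted growth strings, 0-based labels; block i has number i+1).

numBlocks : List ℕ → ℕ
numBlocks = foldr (λ x m → suc x ⊔ m) 0

allRGS : ℕ → List (List ℕ)
allRGS zero    = [] ∷ []
allRGS (suc n) = concatMap (λ w → map (λ c → w ++ (c ∷ [])) (upTo (suc (numBlocks w)))) (allRGS n)

eqList : List ℕ → List ℕ → Bool
eqList []       []       = true
eqList (x ∷ xs) (y ∷ ys) = (x ≡ᵇ y) ∧ eqList xs ys
eqList _        _        = false

refines : List ℕ → List ℕ → Bool
refines σ π = allB (λ p → allB (λ q → not (proj₁ p ≡ᵇ proj₁ q) ∨ (proj₂ p ≡ᵇ proj₂ q)) z) z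
  where z = zip σ π

isPair : List ℕ → Bool
isPair π = allB (λ l → countB (λ x → x ≡ᵇ l) π ≡ᵇ 2) (upTo (numBlocks π))

pairRGS : ℕ → List (List ℕ)
pairRGS n = filter (λ π → isPair π Data.Bool.≟ true) (allRGS n)
  where import Data.Bool

onê : ℕ → List ℕ
onê n = replicate n 0

-- all pairs {k < l} in the same block, listing (item_k , item_l)
pairsOf : {A : Set} → List (ℕ × A) → List (A × A)
pairsOf []            = []
pairsOf ((l , x) ∷ r) =
  map (λ q → x , proj₂ q) (filter (λ q → proj₁ q Data.Nat.≟ l) r) ++ pairsOf r
  where import Data.Nat

-- Permutations of {0,...,m-1} as lists of values σ(0),...,σ(m-1)

seqs : ℕ → ℕ → List (List ℕ)
seqs zero    m = [] ∷ []
seqs (suc k) m = concatMap (λ c → map (c ∷_) (seqs k m)) (upTo m)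

noDup : List ℕ → Bool
noDup []       = true
noDup (x ∷ xs) = not (anyB (λ y → x ≡ᵇ y) xs) ∧ noDup xs

perms : ℕ → List (List ℕ)
perms m = filter (λ s → noDup s Data.Bool.≟ true) (seqs m m)
  where import Data.Bool

indexOf : ℕ → List ℕ → ℕ
indexOf j []       = 0
indexOf j (x ∷ xs) = if j ≡ᵇ x then 0 else suc (indexOf j xs)

-- π_σ ∈ Π^{(2)}_{2m}: pairs {i, m+σ(i)} (0-based), as canonical labels:
-- position i has label i, position m+j has label σ⁻¹(j)
piSigma : ℕ → List ℕ → List ℕ
piSigma m σ = upTo m ++ map (λ j → indexOf j σ) (upTo m)

module Fock {c ℓ : Level} (R : CommutativeRing c ℓ) (t : List ℕ → CommutativeRing.Carrier R) where
  open CommutativeRing R hiding (_≈_; 0#; 1#)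
  open CommutativeRing R public using (_≈_; 0#; 1#)

  Σ' : {A : Set} → List A → (A → Carrier) → Carrier
  Σ' xs f = foldr (λ x s → f x + s) 0# xs

  Π' : {A : Set} → List A → (A → Carrier) → Carrier
  Π' xs f = foldr (λ x s → f x * s) 1# xs

  Q : Eps → Eps → Carrier
  Q star one = 1#
  Q _    _   = 0#

  -- ⟨u_c h, u_d h⟩ = δ_{cd} for the unit vector h
  ip : ℕ → ℕ → Carrier
  ip c d = if c ≡ᵇ d then 1# else 0#

  -- ρ on a word in L^ε(u_c h) (letters (ε, c)), via the Fock-state formula
  ρ : List (Eps × ℕ) → Carrier
  ρ w = Σ' (pairRGS (length w)) λ π →
          t π * Π' (pairsOf (zip π w)) (λ p → Q (proj₁ (proj₁ p)) (proj₁ (proj₂ p))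
                                              * ip (proj₂ (proj₁ p)) (proj₂ (proj₂ p)))

  colour : ℕ → List Eps → List (Eps × ℕ)
  colour c = map (λ e → e , c)

  -- ρ(X) := ρ(X^{(1)}) for X ∈ C(H)
  ρH : List Eps → Carrier
  ρH w = ρ (colour 1 w)

  -- ρ_σ(X_1,…,X_n) = ρ(X_1^{(σ(1))} ⋯ X_n^{(σ(n))})   (block numbers = label+1)
  ρσ : List ℕ → List Pow → Carrier
  ρσ σ ks = ρ (concatMap (λ p → colour (suc (proj₁ p)) (word (proj₂ p))) (zip σ ks))

  -- Möbius function of a finite poset (list P, order le), by the defining
  -- recursion μ(σ,σ)=1, μ(σ,π) = -Σ_{σ≤τ<π} μ(σ,τ); fuel bounds chain length.
  mobF : {A : Set} → List A → (A → A → Bool) → (A → A → Bool) → ℕ → A → A → Carrier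
  mobF P le eq zero    σ π = 0#
  mobF P le eq (suc f) σ π =
    if eq σ π then 1#
    else if le σ π
      then - Σ' (filter (λ τ → (le σ τ ∧ le τ π ∧ not (eq τ π)) Data.Bool.≟ true) P) (λ τ → mobF P le eq f σ τ)
      else 0#
    where import Data.Bool

  μ : ℕ → List ℕ → List ℕ → Carrier
  μ n = mobF (allRGS n) refines eqList (length (allRGS n))

  Kπ : List ℕ → List Pow → Carrier
  Kπ π ks = Σ' (filter (λ σ → refines σ π Data.Bool.≟ true) (allRGS (length ks)))
                 (λ σ → ρσ σ ks * μ (length ks) σ π)
    where import Data.Bool

  K : List Pow → Carrier
  K ks = Kπ (onê (length ks)) ks

{-# OPTIONS --safe #-}

-- Expanding ρ_σ by the Fock formula writes each term of K_π as a sum over pair partitions p of the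
-- letters, weighted by t(p) and restricted to admissible p (every pair is an L* followed by an L)
-- whose pairs only join factors lying in one block of σ. Those σ are exactly the partitions above
-- the partition γ_p into factors connected by p, so Möbius inversion leaves Σ_p t(p) [γ_p = π]; in
-- particular K_n sums t(p) over the admissible pairings connecting all n factors.
-- Such a pairing exists only for L*,…,L*,L^(n-1): a last star has no later partner, the L's must
-- match the n-1 stars one to one, and a power factor before the last one is cut off from the last
-- factor together with the stars paired into it. For L*,…,L*,L^(n-1) every admissible pairing is
-- connected, which gives ρ((L*)^(n-1) L^(n-1)). With one letter per factor γ_p = p, so K_π is t(π)
-- on admissible pair partitions π, and these are exactly the π_σ.

module Submission where

open import Defs
open import Level using (Level)
open import Algebra.Bundles using (CommutativeRing)
open import Data.Bool using (Bool; true; false; _∧_; _∨_; not; if_then_else_)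
import Data.Bool as Bool
import Data.Bool.Properties as BoolP
open import Data.Empty using (⊥; ⊥-elim)
open import Data.List using (List; []; _∷_; _++_; map; concatMap; filter; length; replicate; upTo; zip; applyUpTo; take; drop)
open import Data.Nat using (ℕ; suc)
import Data.List.Properties as ListP
open import Data.List.Membership.Propositional using (_∈_; find; lose)
open import Data.List.Membership.Propositional.Properties
open import Data.List.Relation.Unary.Any using (here; there)
open import Data.List.Relation.Unary.All as All using (All; []; _∷_)
open import Data.Product using (_×_; _,_; proj₁; proj₂; Σ; ∃)
open import Data.Sum using (_⊎_; inj₁; inj₂)
open import Data.Vec as Vec using (Vec; _∷ʳ_; toList)
import Data.Vec.Properties as VecP
open import Relation.Nullary using (¬_; Dec; yes; no; _×-dec_)

module Combinatorics where

  open import Data.Nat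
  open import Data.Nat.Properties
  open import Relation.Binary.PropositionalEquality
  open import Relation.Binary.Definitions using (tri<; tri≈; tri>)
  import Data.Fin as Fin
  import Data.Fin.Properties as FinP
  open import Function using (Equivalence; _$_)

  at : {A : Set} → A → List A → ℕ → A
  at d []       i       = d
  at d (x ∷ xs) zero    = x
  at d (x ∷ xs) (suc i) = at d xs i

  _‼_ : List ℕ → ℕ → ℕ
  xs ‼ i = at 0 xs i

  at-++ˡ : {A : Set} (d : A) (xs ys : List A) (i : ℕ) → i < length xs → at d (xs ++ ys) i ≡ at d xs i
  at-++ˡ d (x ∷ xs) ys zero    _         = refl
  at-++ˡ d (x ∷ xs) ys (suc i) (s≤s i<) = at-++ˡ d xs ys i i<

  at-++ʳ : {A : Set} (d : A) (xs ys : List A) (i : ℕ) → at d (xs ++ ys) (length xs + i) ≡ at d ys i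
  at-++ʳ d []       ys i = refl
  at-++ʳ d (x ∷ xs) ys i = at-++ʳ d xs ys i

  at-++ʳ-∸ : {A : Set} (d : A) (xs ys : List A) (i : ℕ) → length xs ≤ i → at d (xs ++ ys) i ≡ at d ys (i ∸ length xs)
  at-++ʳ-∸ d []       ys i       _        = refl
  at-++ʳ-∸ d (x ∷ xs) ys (suc i) (s≤s ≤i) = at-++ʳ-∸ d xs ys i ≤i

  at-++-cases : {A : Set} (d : A) (xs ys : List A) (i : ℕ) → i < length (xs ++ ys) →
    (i < length xs × at d (xs ++ ys) i ≡ at d xs i) ⊎
    (length xs ≤ i × i ∸ length xs < length ys × at d (xs ++ ys) i ≡ at d ys (i ∸ length xs))
  at-++-cases d xs ys i i< with i <? length xs
  ... | yes i<xs = inj₁ (i<xs , at-++ˡ d xs ys i i<xs)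
  ... | no  i≮xs = inj₂ (xs≤i , i∸<ys , at-++ʳ-∸ d xs ys i xs≤i)
    where
      xs≤i = ≮⇒≥ i≮xs
      i∸<ys : i ∸ length xs < length ys
      i∸<ys = subst (i ∸ length xs <_)
        (trans (cong (_∸ length xs) (ListP.length-++ xs)) (m+n∸m≡n (length xs) (length ys)))
        (∸-monoˡ-< i< xs≤i)

  at-map : {A B : Set} (f : A → B) (d : A) (d′ : B) (xs : List A) (i : ℕ) → i < length xs →
           at d′ (map f xs) i ≡ f (at d xs i)
  at-map f d d′ (x ∷ xs) zero    _        = refl
  at-map f d d′ (x ∷ xs) (suc i) (s≤s i<) = at-map f d d′ xs i i<

  at-applyUpTo : {A : Set} (d : A) (f : ℕ → A) (n i : ℕ) → i < n → at d (applyUpTo f n) i ≡ f i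
  at-applyUpTo d f (suc n) zero    _        = refl
  at-applyUpTo d f (suc n) (suc i) (s≤s i<) = at-applyUpTo d (λ k → f (suc k)) n i i<

  at-upTo : ∀ n i → i < n → upTo n ‼ i ≡ i
  at-upTo = at-applyUpTo 0 (λ i → i)

  at-replicate : {A : Set} (d x : A) (n i : ℕ) → i < n → at d (replicate n x) i ≡ x
  at-replicate d x (suc n) zero    _        = refl
  at-replicate d x (suc n) (suc i) (s≤s i<) = at-replicate d x n i i<

  at-zip : {A B : Set} (a : A) (b : B) (xs : List A) (ys : List B) (i : ℕ) →
           length xs ≡ length ys → at (a , b) (zip xs ys) i ≡ (at a xs i , at b ys i)
  at-zip a b []       []       i       _ = refl
  at-zip a b (x ∷ xs) (y ∷ ys) zero    _ = refl
  at-zip a b (x ∷ xs) (y ∷ ys) (suc i) e = at-zip a b xs ys i (suc-injective e)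

  at-take : ∀ a i (xs : List ℕ) → i < a → take a xs ‼ i ≡ xs ‼ i
  at-take (suc a) zero    []       _        = refl
  at-take (suc a) zero    (x ∷ xs) _        = refl
  at-take (suc a) (suc i) []       _        = refl
  at-take (suc a) (suc i) (x ∷ xs) (s≤s i<) = at-take a i xs i<

  at-ext : {A : Set} (d : A) (xs ys : List A) → length xs ≡ length ys →
           (∀ i → i < length xs → at d xs i ≡ at d ys i) → xs ≡ ys
  at-ext d []       []       _ _  = refl
  at-ext d (x ∷ xs) (y ∷ ys) e eq =
    cong₂ _∷_ (eq zero z<s) (at-ext d xs ys (suc-injective e) (λ i i< → eq (suc i) (s≤s i<)))

  length-zip : {A B : Set} (xs : List A) (ys : List B) → length xs ≡ length ys → length (zip xs ys) ≡ length xs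
  length-zip []       []       _ = refl
  length-zip (x ∷ xs) (y ∷ ys) e = cong suc (length-zip xs ys (suc-injective e))

  length-take-≤ : ∀ a (xs : List ℕ) → a ≤ length xs → length (take a xs) ≡ a
  length-take-≤ a xs a≤ = trans (ListP.length-take a xs) (m≤n⇒m⊓n≡m a≤)

  zip-∈ : {X Y : Set} (dx : X) (dy : Y) (xs : List X) (ys : List Y) →
          ∀ {q} → q ∈ zip xs ys → ∃ λ b → b < length xs × b < length ys × q ≡ (at dx xs b , at dy ys b)
  zip-∈ dx dy (x ∷ xs) (y ∷ ys) (here refl) = zero , z<s , z<s , refl
  zip-∈ dx dy (x ∷ xs) (y ∷ ys) (there q∈) with zip-∈ dx dy xs ys q∈
  ... | b , b<xs , b<ys , refl = suc b , s≤s b<xs , s≤s b<ys , refl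

  at∈zip : {X Y : Set} (dx : X) (dy : Y) (xs : List X) (ys : List Y) → length xs ≡ length ys →
           ∀ b → b < length xs → (at dx xs b , at dy ys b) ∈ zip xs ys
  at∈zip dx dy (x ∷ xs) (y ∷ ys) e zero    _        = here refl
  at∈zip dx dy (x ∷ xs) (y ∷ ys) e (suc b) (s≤s b<) = there (at∈zip dx dy xs ys (suc-injective e) b b<)

  ≡ᵇ-true⇒≡ : ∀ m n → (m ≡ᵇ n) ≡ true → m ≡ n
  ≡ᵇ-true⇒≡ m n e = ≡ᵇ⇒≡ m n (Equivalence.from BoolP.T-≡ e)

  ≡ᵇ-refl : ∀ m → (m ≡ᵇ m) ≡ true
  ≡ᵇ-refl m = Equivalence.to BoolP.T-≡ (≡⇒≡ᵇ m m refl)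

  ≢⇒≡ᵇ-false : ∀ m n → m ≢ n → (m ≡ᵇ n) ≡ false
  ≢⇒≡ᵇ-false m n m≢n with m ≡ᵇ n in e
  ... | true  = ⊥-elim (m≢n (≡ᵇ-true⇒≡ m n e))
  ... | false = refl

  ≡ᵇ-false⇒≢ : ∀ m n → (m ≡ᵇ n) ≡ false → m ≢ n
  ≡ᵇ-false⇒≢ m .m e refl with trans (sym e) (≡ᵇ-refl m)
  ... | ()

  bool-ext : ∀ {b c : Bool} → (b ≡ true → c ≡ true) → (c ≡ true → b ≡ true) → b ≡ c
  bool-ext {true}  {true}  _ _ = refl
  bool-ext {true}  {false} f _ = sym (f refl)
  bool-ext {false} {true}  _ g = g refl
  bool-ext {false} {false} _ _ = refl

  ∧-intro : ∀ {a b} → a ≡ true → b ≡ true → (a ∧ b) ≡ true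
  ∧-intro refl refl = refl

  ∧-elim : ∀ {a b} → (a ∧ b) ≡ true → a ≡ true × b ≡ true
  ∧-elim {true} {true} _ = refl , refl

  not-true : ∀ {b} → not b ≡ true → b ≡ false
  not-true {false} _ = refl

  false≢true : false ≢ true
  false≢true ()

  eqList⇒≡ : ∀ xs ys → eqList xs ys ≡ true → xs ≡ ys
  eqList⇒≡ []       []       _ = refl
  eqList⇒≡ (a ∷ xs) (b ∷ ys) e with a ≡ᵇ b in a≡b
  ... | true = cong₂ _∷_ (≡ᵇ-true⇒≡ a b a≡b) (eqList⇒≡ xs ys e)

  eqList-refl : ∀ xs → eqList xs xs ≡ true
  eqList-refl []       = refl
  eqList-refl (a ∷ xs) rewrite ≡ᵇ-refl a = eqList-refl xs

  ≡⇒eqList : ∀ {xs ys} → xs ≡ ys → eqList xs ys ≡ true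
  ≡⇒eqList {xs} refl = eqList-refl xs

  ≢⇒eqList-false : ∀ xs ys → xs ≢ ys → eqList xs ys ≡ false
  ≢⇒eqList-false xs ys xs≢ys with eqList xs ys in e
  ... | true  = ⊥-elim (xs≢ys (eqList⇒≡ xs ys e))
  ... | false = refl

  eqList-sym : ∀ xs ys → eqList xs ys ≡ eqList ys xs
  eqList-sym xs ys = bool-ext (λ e → ≡⇒eqList (sym (eqList⇒≡ xs ys e))) (λ e → ≡⇒eqList (sym (eqList⇒≡ ys xs e)))

  allB-at : {A : Set} (d : A) (p : A → Bool) (xs : List A) → allB p xs ≡ true →
            ∀ i → i < length xs → p (at d xs i) ≡ true
  allB-at d p (x ∷ xs) h i i< with p x in px
  allB-at d p (x ∷ xs) h zero    _        | true = px
  allB-at d p (x ∷ xs) h (suc i) (s≤s i<) | true = allB-at d p xs h i i<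

  at-allB : {A : Set} (d : A) (p : A → Bool) (xs : List A) →
            (∀ i → i < length xs → p (at d xs i) ≡ true) → allB p xs ≡ true
  at-allB d p []       _ = refl
  at-allB d p (x ∷ xs) h rewrite h zero z<s = at-allB d p xs (λ i i< → h (suc i) (s≤s i<))

  allB⇒All : {A : Set} (p : A → Bool) (xs : List A) → allB p xs ≡ true → All (λ x → p x ≡ true) xs
  allB⇒All p []       _ = []
  allB⇒All p (x ∷ xs) h with p x in px
  ... | true = px ∷ allB⇒All p xs h

  All⇒allB : {A : Set} (p : A → Bool) (xs : List A) → All (λ x → p x ≡ true) xs → allB p xs ≡ true
  All⇒allB p []       _         = refl
  All⇒allB p (x ∷ xs) (px ∷ h) rewrite px = All⇒allB p xs h

  allB-const : {A : Set} (xs : List A) → allB (λ _ → true) xs ≡ true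
  allB-const []       = refl
  allB-const (x ∷ xs) = allB-const xs

  eqList-∷ʳ : ∀ (w v : List ℕ) c d → length w ≡ length v → eqList (w ++ c ∷ []) (v ++ d ∷ []) ≡ (eqList w v ∧ (c ≡ᵇ d))
  eqList-∷ʳ []      []      c d _ = BoolP.∧-identityʳ (c ≡ᵇ d)
  eqList-∷ʳ (x ∷ w) (y ∷ v) c d e rewrite eqList-∷ʳ w v c d (suc-injective e) = sym (BoolP.∧-assoc (x ≡ᵇ y) (eqList w v) (c ≡ᵇ d))

  count : ℕ → List ℕ → ℕ
  count l = countB (λ x → x ≡ᵇ l)

  count-here : ∀ l x xs → x ≡ l → count l (x ∷ xs) ≡ suc (count l xs)
  count-here l x xs refl rewrite ≡ᵇ-refl l = refl

  count-there : ∀ l x xs → x ≢ l → count l (x ∷ xs) ≡ count l xs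
  count-there l x xs x≢l rewrite ≢⇒≡ᵇ-false x l x≢l = refl

  count-∷-≥ : ∀ l x xs → count l xs ≤ count l (x ∷ xs)
  count-∷-≥ l x xs with x ≟ l
  ... | yes x≡l = ≤-trans (n≤1+n _) (≤-reflexive (sym (count-here l x xs x≡l)))
  ... | no  x≢l = ≤-reflexive (sym (count-there l x xs x≢l))

  count-++ : ∀ l xs ys → count l (xs ++ ys) ≡ count l xs + count l ys
  count-++ l []       ys = refl
  count-++ l (x ∷ xs) ys with x ≡ᵇ l
  ... | true  = cong suc (count-++ l xs ys)
  ... | false = count-++ l xs ys

  count-replicate-self : ∀ l n → count l (replicate n l) ≡ n
  count-replicate-self l zero    = refl
  count-replicate-self l (suc n) = trans (count-here l l (replicate n l) refl) (cong suc (count-replicate-self l n))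

  count-replicate-other : ∀ l x n → x ≢ l → count l (replicate n x) ≡ 0
  count-replicate-other l x zero    _   = refl
  count-replicate-other l x (suc n) x≢l = trans (count-there l x (replicate n x) x≢l) (count-replicate-other l x n x≢l)

  count-absent : ∀ l xs → (∀ i → i < length xs → xs ‼ i ≢ l) → count l xs ≡ 0
  count-absent l []       _      = refl
  count-absent l (x ∷ xs) absent =
    trans (count-there l x xs (absent 0 z<s)) (count-absent l xs (λ i i< → absent (suc i) (s≤s i<)))

  count-unique : ∀ l xs → (∀ i j → i < length xs → j < length xs → xs ‼ i ≡ l → xs ‼ j ≡ l → i ≡ j) →
                 ∀ i → i < length xs → xs ‼ i ≡ l → count l xs ≡ 1
  count-unique l (x ∷ xs) unique zero _ x≡l =
    trans (count-here l x xs x≡l)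
          (cong suc (count-absent l xs λ i i< e → 0≢1+n (unique 0 (suc i) z<s (s≤s i<) x≡l e)))
  count-unique l (x ∷ xs) unique (suc i) (s≤s i<) e =
    trans (count-there l x xs (λ x≡l → 0≢1+n (unique 0 (suc i) z<s (s≤s i<) x≡l e)))
          (count-unique l xs (λ a b a< b< ea eb → suc-injective (unique (suc a) (suc b) (s≤s a<) (s≤s b<) ea eb)) i i< e)

  count-≥1 : ∀ l xs i → i < length xs → xs ‼ i ≡ l → 1 ≤ count l xs
  count-≥1 l (x ∷ xs) zero    _        e = subst (1 ≤_) (sym (count-here l x xs e)) (s≤s z≤n)
  count-≥1 l (x ∷ xs) (suc i) (s≤s i<) e = ≤-trans (count-≥1 l xs i i< e) (count-∷-≥ l x xs)

  count-≥2 : ∀ l xs i j → i ≢ j → i < length xs → j < length xs → xs ‼ i ≡ l → xs ‼ j ≡ l → 2 ≤ count l xs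
  count-≥2 l (x ∷ xs) zero    zero    i≢j _        _        _  _  = ⊥-elim (i≢j refl)
  count-≥2 l (x ∷ xs) zero    (suc j) _   _        (s≤s j<) ei ej =
    subst (2 ≤_) (sym (count-here l x xs ei)) (s≤s (count-≥1 l xs j j< ej))
  count-≥2 l (x ∷ xs) (suc i) zero    _   (s≤s i<) _        ei ej =
    subst (2 ≤_) (sym (count-here l x xs ej)) (s≤s (count-≥1 l xs i i< ei))
  count-≥2 l (x ∷ xs) (suc i) (suc j) i≢j (s≤s i<) (s≤s j<) ei ej =
    ≤-trans (count-≥2 l xs i j (λ e → i≢j (cong suc e)) i< j< ei ej) (count-∷-≥ l x xs)

  count-≥3 : ∀ l xs i j k → i ≢ j → i ≢ k → j ≢ k → i < length xs → j < length xs → k < length xs →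
             xs ‼ i ≡ l → xs ‼ j ≡ l → xs ‼ k ≡ l → 3 ≤ count l xs
  count-≥3 l (x ∷ xs) zero zero _ i≢j _ _ _ _ _ _ _ _ = ⊥-elim (i≢j refl)
  count-≥3 l (x ∷ xs) zero (suc j) zero _ i≢k _ _ _ _ _ _ _ = ⊥-elim (i≢k refl)
  count-≥3 l (x ∷ xs) zero (suc j) (suc k) _ _ j≢k _ (s≤s j<) (s≤s k<) ei ej ek =
    subst (3 ≤_) (sym (count-here l x xs ei)) (s≤s (count-≥2 l xs j k (λ e → j≢k (cong suc e)) j< k< ej ek))
  count-≥3 l (x ∷ xs) (suc i) zero zero _ _ j≢k _ _ _ _ _ _ = ⊥-elim (j≢k refl)
  count-≥3 l (x ∷ xs) (suc i) zero (suc k) _ i≢k _ (s≤s i<) _ (s≤s k<) ei ej ek =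
    subst (3 ≤_) (sym (count-here l x xs ej)) (s≤s (count-≥2 l xs i k (λ e → i≢k (cong suc e)) i< k< ei ek))
  count-≥3 l (x ∷ xs) (suc i) (suc j) zero i≢j _ _ (s≤s i<) (s≤s j<) _ ei ej ek =
    subst (3 ≤_) (sym (count-here l x xs ek)) (s≤s (count-≥2 l xs i j (λ e → i≢j (cong suc e)) i< j< ei ej))
  count-≥3 l (x ∷ xs) (suc i) (suc j) (suc k) i≢j i≢k j≢k (s≤s i<) (s≤s j<) (s≤s k<) ei ej ek =
    ≤-trans (count-≥3 l xs i j k (λ e → i≢j (cong suc e)) (λ e → i≢k (cong suc e)) (λ e → j≢k (cong suc e)) i< j< k< ei ej ek)
            (count-∷-≥ l x xs)

  occurrence : ∀ l xs → 1 ≤ count l xs → ∃ λ i → i < length xs × xs ‼ i ≡ l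
  occurrence l (x ∷ xs) h with x ≟ l
  ... | yes x≡l = zero , z<s , x≡l
  ... | no  x≢l with occurrence l xs (subst (1 ≤_) (count-there l x xs x≢l) h)
  ...   | i , i< , e = suc i , s≤s i< , e

  other-occurrence : ∀ l xs a → 2 ≤ count l xs → a < length xs → xs ‼ a ≡ l →
                     ∃ λ b → b < length xs × b ≢ a × xs ‼ b ≡ l
  other-occurrence l (x ∷ xs) zero h _ e with occurrence l xs (≤-pred (subst (2 ≤_) (count-here l x xs e) h))
  ... | i , i< , ei = suc i , s≤s i< , (λ ()) , ei
  other-occurrence l (x ∷ xs) (suc a) h (s≤s a<) e with x ≟ l
  ... | yes x≡l = zero , z<s , (λ ()) , x≡l
  ... | no  x≢l with other-occurrence l xs a (subst (2 ≤_) (count-there l x xs x≢l) h) a< e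
  ...   | b , b< , b≢a , eb = suc b , s≤s b< , (λ e′ → b≢a (suc-injective e′)) , eb

  count≤2⇒third-occurrence-repeats : ∀ l xs i j k → count l xs ≤ 2 → i < length xs → j < length xs → k < length xs →
    xs ‼ i ≡ l → xs ‼ j ≡ l → xs ‼ k ≡ l → i ≢ j → i ≢ k → j ≡ k
  count≤2⇒third-occurrence-repeats l xs i j k h i< j< k< ei ej ek i≢j i≢k with j ≟ k
  ... | yes j≡k = j≡k
  ... | no  j≢k = ⊥-elim (<-irrefl refl (≤-trans (count-≥3 l xs i j k i≢j i≢k j≢k i< j< k< ei ej ek) h))

  search : ∀ n (P : ℕ → Set) → (∀ i → Dec (P i)) → (∃ λ i → i < n × P i) ⊎ (∀ i → i < n → ¬ P i)
  search zero    P P? = inj₂ (λ i ())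
  search (suc n) P P? with search n P P?
  ... | inj₁ (i , i< , Pi) = inj₁ (i , m<n⇒m<1+n i< , Pi)
  ... | inj₂ none with P? n
  ...   | yes Pn = inj₁ (n , ≤-refl , Pn)
  ...   | no ¬Pn = inj₂ λ i i< Pi → case m<1+n⇒m<n∨m≡n i< of λ where
            (inj₁ i<n) → none i i<n Pi
            (inj₂ refl) → ¬Pn Pi
    where open import Function using (case_of_)

  search? : ∀ n (P : ℕ → Set) → (∀ i → Dec (P i)) → Dec (∃ λ i → i < n × P i)
  search? n P P? with search n P P?
  ... | inj₁ found = yes found
  ... | inj₂ none  = no λ (i , i< , Pi) → none i i< Pi

  InjectiveBelow : ℕ → (ℕ → ℕ) → Set
  InjectiveBelow n f = ∀ i j → i < n → j < n → f i ≡ f j → i ≡ j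

  pigeonhole : ∀ k n (f : ℕ → ℕ) → k < n → (∀ i → i < n → f i < k) → ¬ InjectiveBelow n f
  pigeonhole k n f k<n f< inj with FinP.pigeonhole k<n (λ i → Fin.fromℕ< (f< (Fin.toℕ i) (FinP.toℕ<n i)))
  ... | i , j , i<j , e = <-irrefl (inj (Fin.toℕ i) (Fin.toℕ j) (FinP.toℕ<n i) (FinP.toℕ<n j)
          (trans (sym (FinP.toℕ-fromℕ< (f< (Fin.toℕ i) (FinP.toℕ<n i))))
                 (trans (cong Fin.toℕ e) (FinP.toℕ-fromℕ< (f< (Fin.toℕ j) (FinP.toℕ<n j)))))) i<j

  pigeonhole-rel : ∀ k n (R : ℕ → ℕ → Set) → k < n → (∀ i → i < n → ∃ λ b → b < k × R i b) →
                   (∀ i j b → i < n → j < n → R i b → R j b → i ≡ j) → ⊥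
  pigeonhole-rel k n R k<n total functional = pigeonhole k n f k<n f< f-inj
    where
      f : ℕ → ℕ
      f i with i <? n
      ... | yes i< = proj₁ (total i i<)
      ... | no  _  = 0
      f< : ∀ i → i < n → f i < k
      f< i i< with i <? n
      ... | yes i<′ = proj₁ (proj₂ (total i i<′))
      ... | no  i≮  = ⊥-elim (i≮ i<)
      Rf : ∀ i → i < n → R i (f i)
      Rf i i< with i <? n
      ... | yes i<′ = proj₂ (proj₂ (total i i<′))
      ... | no  i≮  = ⊥-elim (i≮ i<)
      f-inj : InjectiveBelow n f
      f-inj i j i< j< e = functional i j (f i) i< j< (Rf i i<) (subst (R j) (sym e) (Rf j j<))

  -- If y is missed, squeezing the values above y down by one maps [m+1] injectively into [m].
  injective⇒surjective : ∀ m (f : ℕ → ℕ) → (∀ i → i < m → f i < m) → InjectiveBelow m f →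
                         ∀ y → y < m → ∃ λ i → i < m × f i ≡ y
  injective⇒surjective m f f< inj y y<m with search m (λ i → f i ≡ y) (λ i → f i ≟ y)
  ... | inj₁ found = found
  injective⇒surjective (suc m) f f< inj y y<m | inj₂ missed = ⊥-elim (pigeonhole m (suc m) g ≤-refl g< g-inj)
    where
      g : ℕ → ℕ
      g i with f i <? y
      ... | yes _ = f i
      ... | no  _ = pred (f i)
      above : ∀ i → i < suc m → ¬ (f i < y) → y < f i
      above i i< f≮y = ≤∧≢⇒< (≮⇒≥ f≮y) (λ e → missed i i< (sym e))
      g< : ∀ i → i < suc m → g i < m
      g< i i< with f i <? y
      ... | yes f<y = <-≤-trans f<y (≤-pred y<m)
      ... | no  f≮y = pred< (above i i< f≮y) (f< i i<)
        where
          pred< : ∀ {u} → y < u → u < suc m → pred u < m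
          pred< {suc u} _ (s≤s u<m) = u<m
      g-inj : InjectiveBelow (suc m) g
      g-inj i j i< j< e with f i <? y | f j <? y
      ... | yes _   | yes _   = inj i j i< j< e
      ... | no  f≮y | no  g≮y = inj i j i< j< (pred-injective-above (above i i< f≮y) (above j j< g≮y) e)
        where
          pred-injective-above : ∀ {u v} → y < u → y < v → pred u ≡ pred v → u ≡ v
          pred-injective-above {suc u} {suc v} _ _ e′ = cong suc e′
      ... | yes f<y | no  g≮y = ⊥-elim (<-irrefl refl (<-≤-trans f<y (subst (y ≤_) (sym e) (<⇒≤pred (above j j< g≮y)))))
      ... | no  f≮y | yes g<y = ⊥-elim (<-irrefl refl (<-≤-trans g<y (subst (y ≤_) e (<⇒≤pred (above i i< f≮y)))))

  -- Set partitions as restricted growth strings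

  data RGS : ℕ → List ℕ → Set where
    rnil  : RGS 0 []
    rsnoc : ∀ {n w c} → RGS n w → c ≤ numBlocks w → RGS (suc n) (w ++ c ∷ [])

  RGS-length : ∀ {n w} → RGS n w → length w ≡ n
  RGS-length rnil                      = refl
  RGS-length (rsnoc {w = w} {c} r _) =
    trans (ListP.length-++ w) (trans (+-comm (length w) 1) (cong suc (RGS-length r)))

  numBlocks-++ : (xs ys : List ℕ) → numBlocks (xs ++ ys) ≡ numBlocks xs ⊔ numBlocks ys
  numBlocks-++ []       ys = refl
  numBlocks-++ (x ∷ xs) ys =
    trans (cong (suc x ⊔_) (numBlocks-++ xs ys)) (sym (⊔-assoc (suc x) (numBlocks xs) (numBlocks ys)))

  numBlocks-∷ʳ : (xs : List ℕ) (c : ℕ) → numBlocks (xs ++ c ∷ []) ≡ numBlocks xs ⊔ suc c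
  numBlocks-∷ʳ xs c = trans (numBlocks-++ xs (c ∷ [])) (cong (numBlocks xs ⊔_) (⊔-identityʳ (suc c)))

  at<numBlocks : (xs : List ℕ) (i : ℕ) → i < length xs → xs ‼ i < numBlocks xs
  at<numBlocks (x ∷ xs) zero    _        = m≤m⊔n (suc x) (numBlocks xs)
  at<numBlocks (x ∷ xs) (suc i) (s≤s i<) = ≤-trans (at<numBlocks xs i i<) (m≤n⊔m (suc x) (numBlocks xs))

  numBlocks-≤ : ∀ k xs → (∀ i → i < length xs → xs ‼ i < k) → numBlocks xs ≤ k
  numBlocks-≤ k []       _  = z≤n
  numBlocks-≤ k (x ∷ xs) x< = ⊔-lub (x< 0 z<s) (numBlocks-≤ k xs (λ i i< → x< (suc i) (s≤s i<)))

  numBlocks-upTo : ∀ m → numBlocks (upTo m) ≡ m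
  numBlocks-upTo zero    = refl
  numBlocks-upTo (suc m) =
    trans (cong numBlocks (sym (ListP.upTo-∷ʳ m)))
          (trans (numBlocks-∷ʳ (upTo m) m) (trans (cong (_⊔ suc m) (numBlocks-upTo m)) (m≤n⇒m⊔n≡n (n≤1+n m))))

  at-∷ʳ-< : ∀ (w : List ℕ) c i → i < length w → (w ++ c ∷ []) ‼ i ≡ w ‼ i
  at-∷ʳ-< w c = at-++ˡ 0 w (c ∷ [])

  at-∷ʳ-last : ∀ (w : List ℕ) c n → length w ≡ n → (w ++ c ∷ []) ‼ n ≡ c
  at-∷ʳ-last w c n refl = trans (cong ((w ++ c ∷ []) ‼_) (sym (+-identityʳ (length w)))) (at-++ʳ 0 w (c ∷ []) 0)

  RGS⇒∈allRGS : ∀ {n w} → RGS n w → w ∈ allRGS n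
  RGS⇒∈allRGS rnil                     = here refl
  RGS⇒∈allRGS (rsnoc {w = w} r c≤) =
    ∈-concatMap⁺ (λ w → map (λ c → w ++ (c ∷ [])) (upTo (suc (numBlocks w))))
      (lose (RGS⇒∈allRGS r) (∈-map⁺ (λ c → w ++ (c ∷ [])) (∈-upTo⁺ (s≤s c≤))))

  ∈allRGS⇒RGS : ∀ n {w} → w ∈ allRGS n → RGS n w
  ∈allRGS⇒RGS zero    (here refl) = rnil
  ∈allRGS⇒RGS (suc n) w∈ with find (∈-concatMap⁻ (λ w → map (λ c → w ++ (c ∷ [])) (upTo (suc (numBlocks w)))) w∈)
  ... | w , w∈′ , v∈ with ∈-map⁻ (λ c → w ++ (c ∷ [])) v∈
  ...   | c , c∈ , refl = rsnoc (∈allRGS⇒RGS n w∈′) (≤-pred (∈-upTo⁻ c∈))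

  RGS-surjective : ∀ {n w} → RGS n w → ∀ v → v < numBlocks w → ∃ λ i → i < n × w ‼ i ≡ v
  RGS-surjective (rsnoc {n} {w} {c} r c≤) v v< with v <? numBlocks w
  ... | yes v<w with RGS-surjective r v v<w
  ...   | i , i< , e = i , m<n⇒m<1+n i< , trans (at-∷ʳ-< w c i (subst (i <_) (sym (RGS-length r)) i<)) e
  RGS-surjective (rsnoc {n} {w} {c} r c≤) v v< | no v≮w =
    n , ≤-refl , trans (at-∷ʳ-last w c n (RGS-length r)) (sym v≡c)
    where
      v<⊔ : v < numBlocks w ⊔ suc c
      v<⊔ = subst (v <_) (numBlocks-∷ʳ w c) v<
      v≡c : v ≡ c
      v≡c with suc c ≤? numBlocks w
      ... | yes c<w = ⊥-elim (v≮w (subst (v <_) (m≥n⇒m⊔n≡m c<w) v<⊔))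
      ... | no  c≮w = ≤-antisym (≤-pred (subst (v <_) (m≤n⇒m⊔n≡n (≤-trans (n≤1+n _) (≰⇒> c≮w))) v<⊔))
                                (≤-trans c≤ (≮⇒≥ v≮w))

  RGS-head : ∀ {n w} → RGS (suc n) w → w ‼ 0 ≡ 0
  RGS-head (rsnoc rnil z≤n) = refl
  RGS-head (rsnoc {w = w} (rsnoc r c≤) _) =
    trans (at-∷ʳ-< w _ 0 (subst (0 <_) (sym (RGS-length (rsnoc r c≤))) z<s)) (RGS-head (rsnoc r c≤))

  take-∷ʳ : ∀ a (xs : List ℕ) x → a ≤ length xs → take a (xs ++ x ∷ []) ≡ take a xs
  take-∷ʳ zero    xs       x _        = refl
  take-∷ʳ (suc a) (y ∷ xs) x (s≤s a≤) = cong (y ∷_) (take-∷ʳ a xs x a≤)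

  RGS-bound : ∀ {n w} → RGS n w → ∀ a → a < n → w ‼ a ≤ numBlocks (take a w)
  RGS-bound (rsnoc {n} {w} {c} r c≤) a a< with m<1+n⇒m<n∨m≡n a<
  ... | inj₁ a<n = subst₂ _≤_ (sym (at-∷ʳ-< w c a (subst (a <_) (sym (RGS-length r)) a<n)))
                     (cong numBlocks (sym (take-∷ʳ a w c (subst (a ≤_) (sym (RGS-length r)) (<⇒≤ a<n)))))
                     (RGS-bound r a a<n)
  ... | inj₂ refl = subst₂ _≤_ (sym (at-∷ʳ-last w c a (RGS-length r))) (cong numBlocks (sym take-w)) c≤
    where
      take-w : take a (w ++ c ∷ []) ≡ w
      take-w rewrite sym (RGS-length r) = trans (take-∷ʳ (length w) w c ≤-refl) (ListP.take-all (length w) w ≤-refl)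

  RGS-++ : ∀ {n w} → RGS n w → ∀ ys → (∀ i → i < length ys → ys ‼ i < numBlocks w) → RGS (n + length ys) (w ++ ys)
  RGS-++ {n} {w} r []       _   = subst₂ RGS (sym (+-identityʳ n)) (sym (ListP.++-identityʳ w)) r
  RGS-++ {n} {w} r (y ∷ ys) ys< =
    subst₂ RGS (sym (+-suc n (length ys))) (ListP.++-assoc w (y ∷ []) ys)
      (RGS-++ (rsnoc r (<⇒≤ (ys< 0 z<s))) ys (λ i i< → <-≤-trans (ys< (suc i) (s≤s i<)) numBlocks-∷ʳ-≥))
    where
      numBlocks-∷ʳ-≥ : numBlocks w ≤ numBlocks (w ++ y ∷ [])
      numBlocks-∷ʳ-≥ = subst (numBlocks w ≤_) (sym (numBlocks-∷ʳ w y)) (m≤m⊔n (numBlocks w) (suc y))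

  RGS-upTo : ∀ m → RGS m (upTo m)
  RGS-upTo zero    = rnil
  RGS-upTo (suc m) = subst (RGS (suc m)) (ListP.upTo-∷ʳ m) (rsnoc (RGS-upTo m) (≤-reflexive (sym (numBlocks-upTo m))))

  RGS-onê : ∀ n → RGS n (onê n)
  RGS-onê zero    = rnil
  RGS-onê (suc n) = subst (RGS (suc n)) (replicate-∷ʳ n) (rsnoc (RGS-onê n) z≤n)
    where
      replicate-∷ʳ : ∀ n → replicate n 0 ++ 0 ∷ [] ≡ replicate (suc n) 0
      replicate-∷ʳ zero    = refl
      replicate-∷ʳ (suc n) = cong (0 ∷_) (replicate-∷ʳ n)

  Finer : ℕ → (ℕ → ℕ) → (ℕ → ℕ) → Set
  Finer n g s = ∀ i j → i < n → j < n → g i ≡ g j → s i ≡ s j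

  Refines : ℕ → List ℕ → List ℕ → Set
  Refines n σ π = Finer n (σ ‼_) (π ‼_)

  Refines-∷ʳ : ∀ n σ π c d → length σ ≡ n → length π ≡ n →
               Refines (suc n) (σ ++ c ∷ []) (π ++ d ∷ []) → Refines n σ π
  Refines-∷ʳ n σ π c d refl lπ σ≤π i j i< j< e =
    trans (sym (at-∷ʳ-< π d i (subst (i <_) (sym lπ) i<)))
      (trans (σ≤π i j (m<n⇒m<1+n i<) (m<n⇒m<1+n j<)
               (trans (at-∷ʳ-< σ c i i<) (trans e (sym (at-∷ʳ-< σ c j j<)))))
             (at-∷ʳ-< π d j (subst (j <_) (sym lπ) j<)))

  -- The new label of a restricted growth string is either old (hence attained earlier) or the next fresh one.
  RGS-antisym : ∀ {n σ π} → RGS n σ → RGS n π → Refines n σ π → Refines n π σ → σ ≡ π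
  RGS-antisym rnil rnil _ _ = refl
  RGS-antisym {suc n} (rsnoc {w = σ} {c = c} rσ c≤) (rsnoc {w = π} {c = d} rπ d≤) σ≤π π≤σ
    with RGS-length rσ | RGS-length rπ
  ... | lσ | lπ with RGS-antisym rσ rπ (Refines-∷ʳ n σ π c d lσ lπ σ≤π) (Refines-∷ʳ n π σ d c lπ lσ π≤σ)
  ...   | refl = cong (λ z → σ ++ z ∷ []) c≡d
    where
      at-< : ∀ x i → i < n → (σ ++ x ∷ []) ‼ i ≡ σ ‼ i
      at-< x i i< = at-∷ʳ-< σ x i (subst (i <_) (sym lσ) i<)
      at-n : ∀ x → (σ ++ x ∷ []) ‼ n ≡ x
      at-n x = at-∷ʳ-last σ x n lσ
      c≡d : c ≡ d
      c≡d with c <? numBlocks σ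
      ... | yes c<σ with RGS-surjective rσ c c<σ
      ...   | i , i< , e = trans (sym e) (trans (sym (at-< d i i<))
                (trans (σ≤π i n (m<n⇒m<1+n i<) ≤-refl (trans (at-< c i i<) (trans e (sym (at-n c))))) (at-n d)))
      c≡d | no c≮σ with d <? numBlocks σ
      ... | yes d<σ with RGS-surjective rσ d d<σ
      ...   | j , j< , e = ⊥-elim (c≮σ (subst (_< numBlocks σ) σj≡c (at<numBlocks σ j (subst (j <_) (sym lσ) j<))))
        where
          σj≡c : σ ‼ j ≡ c
          σj≡c = trans (sym (at-< c j j<))
                   (trans (π≤σ j n (m<n⇒m<1+n j<) ≤-refl (trans (at-< d j j<) (trans e (sym (at-n d))))) (at-n c))
      c≡d | no c≮σ | no d≮σ = trans (≤-antisym c≤ (≮⇒≥ c≮σ)) (≤-antisym (≮⇒≥ d≮σ) d≤)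

  SameKernel : ℕ → List ℕ → (ℕ → ℕ) → Set
  SameKernel n γ f = ∀ i j → i < n → j < n → (γ ‼ i ≡ γ ‼ j → f i ≡ f j) × (f i ≡ f j → γ ‼ i ≡ γ ‼ j)

  SameKernel-∷ʳ : ∀ {n γ} f c → length γ ≡ n → SameKernel n γ f →
    (∀ j → j < n → (γ ‼ j ≡ c → f j ≡ f n) × (f j ≡ f n → γ ‼ j ≡ c)) → SameKernel (suc n) (γ ++ c ∷ []) f
  SameKernel-∷ʳ {γ = γ} f c refl ker new a b a< b< with m<1+n⇒m<n∨m≡n a< | m<1+n⇒m<n∨m≡n b<
  ... | inj₁ a<n  | inj₁ b<n  rewrite at-∷ʳ-< γ c a a<n | at-∷ʳ-< γ c b b<n = ker a b a<n b<n
  ... | inj₁ a<n  | inj₂ refl rewrite at-∷ʳ-< γ c a a<n | at-∷ʳ-last γ c b refl = new a a<n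
  ... | inj₂ refl | inj₁ b<n  rewrite at-∷ʳ-< γ c b b<n | at-∷ʳ-last γ c a refl =
    (λ e → sym (proj₁ (new b b<n) (sym e))) , (λ e → sym (proj₂ (new b b<n) (sym e)))
  ... | inj₂ refl | inj₂ refl = (λ _ → refl) , (λ _ → refl)

  canonical-labelling : ∀ n (f : ℕ → ℕ) → ∃ λ γ → RGS n γ × SameKernel n γ f
  canonical-labelling zero    f = [] , rnil , λ i j ()
  canonical-labelling (suc n) f with canonical-labelling n f
  ... | γ , r , ker with search n (λ i → f i ≡ f n) (λ i → f i ≟ f n)
  ...   | inj₁ (i , i< , fi≡fn) =
    γ ++ γ ‼ i ∷ [] , rsnoc r (<⇒≤ (γ‼<numBlocks i i<)) , SameKernel-∷ʳ {γ = γ} f (γ ‼ i) (RGS-length r) ker old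
    where
      γ‼<numBlocks : ∀ j → j < n → γ ‼ j < numBlocks γ
      γ‼<numBlocks j j< = at<numBlocks γ j (subst (j <_) (sym (RGS-length r)) j<)
      old : ∀ j → j < n → (γ ‼ j ≡ γ ‼ i → f j ≡ f n) × (f j ≡ f n → γ ‼ j ≡ γ ‼ i)
      old j j< = (λ e → trans (proj₁ (ker j i j< i<) e) fi≡fn) , (λ e → proj₂ (ker j i j< i<) (trans e (sym fi≡fn)))
  ...   | inj₂ fresh =
    γ ++ numBlocks γ ∷ [] , rsnoc r ≤-refl , SameKernel-∷ʳ {γ = γ} f (numBlocks γ) (RGS-length r) ker new
    where
      new : ∀ j → j < n → (γ ‼ j ≡ numBlocks γ → f j ≡ f n) × (f j ≡ f n → γ ‼ j ≡ numBlocks γ)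
      new j j< = (λ e → ⊥-elim (<-irrefl e (at<numBlocks γ j (subst (j <_) (sym (RGS-length r)) j<))))
               , (λ e → ⊥-elim (fresh j j< e))

  refines⇒Refines : ∀ n σ π → length σ ≡ n → length π ≡ n → refines σ π ≡ true → Refines n σ π
  refines⇒Refines n σ π refl lπ h i j i< j< e = implies (σ ‼ i) (σ ‼ j) (π ‼ i) (π ‼ j) test-ij e
    where
      implies : ∀ a b c d → (not (a ≡ᵇ b) ∨ (c ≡ᵇ d)) ≡ true → a ≡ b → c ≡ d
      implies a .a c d h refl rewrite ≡ᵇ-refl a = ≡ᵇ-true⇒≡ c d h
      z = zip σ π
      z< : ∀ k → k < n → k < length z
      z< k k< = subst (k <_) (sym (length-zip σ π (sym lπ))) k<
      at-z : ∀ k → at (0 , 0) z k ≡ (σ ‼ k , π ‼ k)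
      at-z k = at-zip 0 0 σ π k (sym lπ)
      test-ij : (not (σ ‼ i ≡ᵇ σ ‼ j) ∨ (π ‼ i ≡ᵇ π ‼ j)) ≡ true
      test-ij = subst₂ (λ u v → (not (proj₁ u ≡ᵇ proj₁ v) ∨ (proj₂ u ≡ᵇ proj₂ v)) ≡ true) (at-z i) (at-z j)
                  (allB-at (0 , 0) _ z (allB-at (0 , 0) _ z h i (z< i i<)) j (z< j j<))

  Refines⇒refines : ∀ n σ π → length σ ≡ n → length π ≡ n → Refines n σ π → refines σ π ≡ true
  Refines⇒refines n σ π refl lπ σ≤π = at-allB (0 , 0) _ z λ i i< → at-allB (0 , 0) _ z λ j j< →
      subst₂ (λ u v → (not (proj₁ u ≡ᵇ proj₁ v) ∨ (proj₂ u ≡ᵇ proj₂ v)) ≡ true) (sym (at-z i)) (sym (at-z j))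
        (test (σ ‼ i) (σ ‼ j) (π ‼ i) (π ‼ j) (σ≤π i j (n< i i<) (n< j j<)))
    where
      test : ∀ a b c d → (a ≡ b → c ≡ d) → (not (a ≡ᵇ b) ∨ (c ≡ᵇ d)) ≡ true
      test a b c d h with a ≡ᵇ b in e
      ... | false = refl
      ... | true rewrite h (≡ᵇ-true⇒≡ a b e) | ≡ᵇ-refl d = refl
      z = zip σ π
      n< : ∀ k → k < length z → k < length σ
      n< k k< = subst (k <_) (length-zip σ π (sym lπ)) k<
      at-z : ∀ k → at (0 , 0) z k ≡ (σ ‼ k , π ‼ k)
      at-z k = at-zip 0 0 σ π k (sym lπ)

  refines-refl : ∀ σ → refines σ σ ≡ true
  refines-refl σ = Refines⇒refines (length σ) σ σ refl refl (λ i j _ _ e → e)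

  countB≤length : {A : Set} (b : A → Bool) (xs : List A) → countB b xs ≤ length xs
  countB≤length b []       = z≤n
  countB≤length b (x ∷ xs) with b x
  ... | true  = s≤s (countB≤length b xs)
  ... | false = m≤n⇒m≤1+n (countB≤length b xs)

  countB-mono : {A : Set} (b₁ b₂ : A → Bool) (xs : List A) →
                (∀ x → x ∈ xs → b₁ x ≡ true → b₂ x ≡ true) → countB b₁ xs ≤ countB b₂ xs
  countB-mono b₁ b₂ []       _ = z≤n
  countB-mono b₁ b₂ (x ∷ xs) h with b₁ x in e₁ | b₂ x in e₂
  ... | true  | true  = s≤s (countB-mono b₁ b₂ xs (λ y y∈ → h y (there y∈)))
  ... | true  | false with trans (sym (h x (here refl) e₁)) e₂
  ...   | ()
  countB-mono b₁ b₂ (x ∷ xs) h | false | true  = m≤n⇒m≤1+n (countB-mono b₁ b₂ xs (λ y y∈ → h y (there y∈)))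
  countB-mono b₁ b₂ (x ∷ xs) h | false | false = countB-mono b₁ b₂ xs (λ y y∈ → h y (there y∈))

  countB-mono-< : {A : Set} (b₁ b₂ : A → Bool) (xs : List A) → (∀ x → x ∈ xs → b₁ x ≡ true → b₂ x ≡ true) →
                  ∀ y → y ∈ xs → b₂ y ≡ true → b₁ y ≡ false → countB b₁ xs < countB b₂ xs
  countB-mono-< b₁ b₂ (x ∷ xs) h y (here refl) e₂ e₁ rewrite e₁ | e₂ = s≤s (countB-mono b₁ b₂ xs (λ z z∈ → h z (there z∈)))
  countB-mono-< b₁ b₂ (x ∷ xs) h y (there y∈) e₂ e₁ with b₁ x in f₁ | b₂ x in f₂
  ... | true  | true  = s≤s (countB-mono-< b₁ b₂ xs (λ z z∈ → h z (there z∈)) y y∈ e₂ e₁)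
  ... | true  | false with trans (sym (h x (here refl) f₁)) f₂
  ...   | ()
  countB-mono-< b₁ b₂ (x ∷ xs) h y (there y∈) e₂ e₁ | false | true  =
    m≤n⇒m≤1+n (countB-mono-< b₁ b₂ xs (λ z z∈ → h z (there z∈)) y y∈ e₂ e₁)
  countB-mono-< b₁ b₂ (x ∷ xs) h y (there y∈) e₂ e₁ | false | false = countB-mono-< b₁ b₂ xs (λ z z∈ → h z (there z∈)) y y∈ e₂ e₁

  ∈⇒1≤countB : {A : Set} (b : A → Bool) (xs : List A) → ∀ y → y ∈ xs → b y ≡ true → 1 ≤ countB b xs
  ∈⇒1≤countB b (x ∷ xs) y (here refl) e rewrite e = s≤s z≤n
  ∈⇒1≤countB b (x ∷ xs) y (there y∈)  e with b x
  ... | true  = s≤s z≤n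
  ... | false = ∈⇒1≤countB b xs y y∈ e

  refines-trans : ∀ n {x y z} → length x ≡ n → length y ≡ n → length z ≡ n →
                  refines x y ≡ true → refines y z ≡ true → refines x z ≡ true
  refines-trans n {x} {y} {z} lx ly lz x≤y y≤z = Refines⇒refines n x z lx lz λ i j i< j< e →
    refines⇒Refines n y z ly lz y≤z i j i< j< (refines⇒Refines n x y lx ly x≤y i j i< j< e)

  refines-antisym : ∀ {n x y} → RGS n x → RGS n y → refines x y ≡ true → refines y x ≡ true → x ≡ y
  refines-antisym {n} {x} {y} rx ry x≤y y≤x = RGS-antisym rx ry
    (refines⇒Refines n x y (RGS-length rx) (RGS-length ry) x≤y) (refines⇒Refines n y x (RGS-length ry) (RGS-length rx) y≤x)

  -- The partition generated by a list of edges

  Respects : (ℕ → ℕ) → List (ℕ × ℕ) → Set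
  Respects s E = All (λ e → s (proj₁ e) ≡ s (proj₂ e)) E

  EdgesBelow : ℕ → List (ℕ × ℕ) → Set
  EdgesBelow n E = All (λ e → proj₁ e < n × proj₂ e < n) E

  merge : (ℕ → ℕ) → ℕ → ℕ → ℕ → ℕ
  merge g a b x = if g x ≡ᵇ g b then g a else g x

  mergeAll : List (ℕ × ℕ) → ℕ → ℕ
  mergeAll []             x = x
  mergeAll ((a , b) ∷ E) = merge (mergeAll E) a b

  merge-cases : ∀ g a b x → (g x ≡ g b × merge g a b x ≡ g a) ⊎ (g x ≢ g b × merge g a b x ≡ g x)
  merge-cases g a b x with g x ≡ᵇ g b in e
  ... | true  = inj₁ (≡ᵇ-true⇒≡ _ _ e , refl)
  ... | false = inj₂ (≡ᵇ-false⇒≢ _ _ e , refl)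

  Finer-merge⇒ : ∀ n g s a b → a < n → b < n → Finer n (merge g a b) s → Finer n g s × s a ≡ s b
  Finer-merge⇒ n g s a b a< b< fine = (λ i j i< j< e → fine i j i< j< (cong-merge e)) , fine a b a< b< merged
    where
      cong-merge : ∀ {x y} → g x ≡ g y → merge g a b x ≡ merge g a b y
      cong-merge {x} {y} e rewrite e = refl
      merged : merge g a b a ≡ merge g a b b
      merged with merge-cases g a b a | merge-cases g a b b
      ... | _               | inj₂ (b≢b , _) = ⊥-elim (b≢b refl)
      ... | inj₁ (_ , ea) | inj₁ (_ , eb)   = trans ea (sym eb)
      ... | inj₂ (_ , ea) | inj₁ (_ , eb)   = trans ea (sym eb)

  Finer-merge⇐ : ∀ n g s a b → a < n → b < n → Finer n g s → s a ≡ s b → Finer n (merge g a b) s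
  Finer-merge⇐ n g s a b a< b< fine sa≡sb i j i< j< e with merge-cases g a b i | merge-cases g a b j
  ... | inj₁ (gi , _)  | inj₁ (gj , _)  = fine i j i< j< (trans gi (sym gj))
  ... | inj₁ (gi , ri) | inj₂ (_ , rj)  = trans (fine i b i< b< gi) (trans (sym sa≡sb) (fine a j a< j< (trans (sym ri) (trans e rj))))
  ... | inj₂ (_ , ri)  | inj₁ (gj , rj) = trans (fine i a i< a< (trans (sym ri) (trans e rj))) (trans sa≡sb (sym (fine j b j< b< gj)))
  ... | inj₂ (_ , ri)  | inj₂ (_ , rj)  = fine i j i< j< (trans (sym ri) (trans e rj))

  Finer-mergeAll⇒Respects : ∀ n E s → EdgesBelow n E → Finer n (mergeAll E) s → Respects s E
  Finer-mergeAll⇒Respects n []             s _                 _    = []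
  Finer-mergeAll⇒Respects n ((a , b) ∷ E) s ((a< , b<) ∷ E<) fine with Finer-merge⇒ n (mergeAll E) s a b a< b< fine
  ... | fine′ , sa≡sb = sa≡sb ∷ Finer-mergeAll⇒Respects n E s E< fine′

  Respects⇒Finer-mergeAll : ∀ n E s → EdgesBelow n E → Respects s E → Finer n (mergeAll E) s
  Respects⇒Finer-mergeAll n []             s _                 _              i j _ _ e = cong s e
  Respects⇒Finer-mergeAll n ((a , b) ∷ E) s ((a< , b<) ∷ E<) (sa≡sb ∷ resp) =
    Finer-merge⇐ n (mergeAll E) s a b a< b< (Respects⇒Finer-mergeAll n E s E< resp) sa≡sb

  record GeneratedPartition (n : ℕ) (E : List (ℕ × ℕ)) : Set where
    field
      labels   : List ℕ
      isRGS    : RGS n labels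
      respects : Respects (labels ‼_) E
      finest   : ∀ s → Respects s E → Finer n (labels ‼_) s

  generatedPartition : ∀ n E → EdgesBelow n E → GeneratedPartition n E
  generatedPartition n E E< with canonical-labelling n (mergeAll E)
  ... | γ , r , ker = record
    { labels   = γ
    ; isRGS    = r
    ; respects = Finer-mergeAll⇒Respects n E (γ ‼_) E< (λ i j i< j< e → proj₂ (ker i j i< j<) e)
    ; finest   = λ s resp i j i< j< e → Respects⇒Finer-mergeAll n E s E< resp i j i< j< (proj₁ (ker i j i< j<) e)
    }

  refines-generated⇔Respects : ∀ {n E} → EdgesBelow n E → (P : GeneratedPartition n E) → ∀ σ → length σ ≡ n →
    (refines (GeneratedPartition.labels P) σ ≡ true → Respects (σ ‼_) E) ×
    (Respects (σ ‼_) E → refines (GeneratedPartition.labels P) σ ≡ true)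
  refines-generated⇔Respects {n} E< P σ lσ =
    (λ h → All.zipWith (λ (e< , e) → refines⇒Refines n γ σ γ-length lσ h _ _ (proj₁ e<) (proj₂ e<) e) (E< , respects)) ,
    (λ resp → Refines⇒refines n γ σ γ-length lσ (finest (σ ‼_) resp))
    where
      open GeneratedPartition P renaming (labels to γ)
      γ-length = RGS-length isRGS

  ∈-pairsOf⁻ : {Y : Set} (d : Y) (p : List ℕ) (w : List Y) → ∀ {x} → x ∈ pairsOf (zip p w) →
               ∃ λ a → ∃ λ b → a < b × b < length p × b < length w × p ‼ a ≡ p ‼ b × x ≡ (at d w a , at d w b)
  ∈-pairsOf⁻ d (l ∷ p) (y ∷ w) x∈ with ∈-++⁻ (map (λ q → y , proj₂ q) (filter (λ q → proj₁ q ≟ l) (zip p w))) x∈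
  ... | inj₁ x∈₁ with ∈-map⁻ (λ q → y , proj₂ q) x∈₁
  ...   | q , q∈ , refl with ∈-filter⁻ (λ q → proj₁ q ≟ l) {xs = zip p w} q∈
  ...     | q∈zip , q≡l with zip-∈ 0 d p w q∈zip
  ...       | b , b<p , b<w , refl = zero , suc b , z<s , s≤s b<p , s≤s b<w , sym q≡l , refl
  ∈-pairsOf⁻ d (l ∷ p) (y ∷ w) x∈ | inj₂ x∈₂ with ∈-pairsOf⁻ d p w x∈₂
  ... | a , b , a<b , b<p , b<w , same , refl = suc a , suc b , s≤s a<b , s≤s b<p , s≤s b<w , same , refl

  ∈-pairsOf⁺ : {Y : Set} (d : Y) (p : List ℕ) (w : List Y) → length p ≡ length w →
               ∀ a b → a < b → b < length p → p ‼ a ≡ p ‼ b → (at d w a , at d w b) ∈ pairsOf (zip p w)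
  ∈-pairsOf⁺ d (l ∷ p) (y ∷ w) e zero (suc b) _ (s≤s b<) same =
    ∈-++⁺ˡ (∈-map⁺ (λ q → y , proj₂ q) (∈-filter⁺ (λ q → proj₁ q ≟ l) (at∈zip 0 d p w (suc-injective e) b b<) (sym same)))
  ∈-pairsOf⁺ d (l ∷ p) (y ∷ w) e (suc a) (suc b) (s≤s a<b) (s≤s b<) same =
    ∈-++⁺ʳ (map (λ q → y , proj₂ q) (filter (λ q → proj₁ q ≟ l) (zip p w))) (∈-pairsOf⁺ d p w (suc-injective e) a b a<b b< same)

  AllPairs : {Y : Set} → Y → (Y × Y → Bool) → List ℕ → List Y → Set
  AllPairs d g p w = ∀ a b → a < b → b < length p → p ‼ a ≡ p ‼ b → g (at d w a , at d w b) ≡ true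

  allB-pairsOf⇒AllPairs : {Y : Set} (d : Y) (g : Y × Y → Bool) (p : List ℕ) (w : List Y) → length p ≡ length w →
                          allB g (pairsOf (zip p w)) ≡ true → AllPairs d g p w
  allB-pairsOf⇒AllPairs d g p w e h a b a<b b< same = All.lookup (allB⇒All g _ h) (∈-pairsOf⁺ d p w e a b a<b b< same)

  AllPairs⇒allB-pairsOf : {Y : Set} (d : Y) (g : Y × Y → Bool) (p : List ℕ) (w : List Y) → length p ≡ length w →
                          AllPairs d g p w → allB g (pairsOf (zip p w)) ≡ true
  AllPairs⇒allB-pairsOf d g p w e h = All⇒allB g _ (All.tabulate λ x∈ → from-positions (∈-pairsOf⁻ d p w x∈))
    where
      from-positions : ∀ {x} → (∃ λ a → ∃ λ b → a < b × b < length p × b < length w × p ‼ a ≡ p ‼ b × x ≡ (at d w a , at d w b)) →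
                       g x ≡ true
      from-positions (a , b , a<b , b< , _ , same , refl) = h a b a<b b< same

  pairRGS⇒ : ∀ N {p} → p ∈ pairRGS N → RGS N p × isPair p ≡ true
  pairRGS⇒ N p∈ with ∈-filter⁻ (λ π → isPair π Bool.≟ true) {xs = allRGS N} p∈
  ... | p∈all , pair = ∈allRGS⇒RGS N p∈all , pair

  isPair⇒count≡2 : ∀ p a → isPair p ≡ true → a < length p → count (p ‼ a) p ≡ 2
  isPair⇒count≡2 p a pair a< =
    ≡ᵇ-true⇒≡ _ 2 (All.lookup (allB⇒All _ (upTo (numBlocks p)) pair) (∈-upTo⁺ (at<numBlocks p a a<)))

  partner : ∀ p a → isPair p ≡ true → a < length p → ∃ λ b → b < length p × b ≢ a × p ‼ b ≡ p ‼ a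
  partner p a pair a< = other-occurrence (p ‼ a) p a (≤-reflexive (sym (isPair⇒count≡2 p a pair a<))) a< refl

  partner-unique : ∀ p a b c → isPair p ≡ true → a < length p → b < length p → c < length p →
                   p ‼ b ≡ p ‼ a → p ‼ c ≡ p ‼ a → b ≢ a → c ≢ a → b ≡ c
  partner-unique p a b c pair a< b< c< eb ec b≢a c≢a =
    count≤2⇒third-occurrence-repeats (p ‼ a) p a b c (≤-reflexive (isPair⇒count≡2 p a pair a<)) a< b< c< refl eb ec
      (λ e → b≢a (sym e)) (λ e → c≢a (sym e))

  Respects-pairsOf⁻ : ∀ s p G → length p ≡ length G → Respects s (pairsOf (zip p G)) →
                      ∀ a b → a < b → b < length p → p ‼ a ≡ p ‼ b → s (G ‼ a) ≡ s (G ‼ b)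
  Respects-pairsOf⁻ s p G e resp a b a<b b< same = All.lookup resp (∈-pairsOf⁺ 0 p G e a b a<b b< same)

  Respects-pairsOf⁺ : ∀ s p G → (∀ a b → a < b → b < length p → p ‼ a ≡ p ‼ b → s (G ‼ a) ≡ s (G ‼ b)) →
                      Respects s (pairsOf (zip p G))
  Respects-pairsOf⁺ s p G resp = All.tabulate λ x∈ → from-positions (∈-pairsOf⁻ 0 p G x∈)
    where
      from-positions : ∀ {x} → (∃ λ a → ∃ λ b → a < b × b < length p × b < length G × p ‼ a ≡ p ‼ b × x ≡ (G ‼ a , G ‼ b)) →
                       s (proj₁ x) ≡ s (proj₂ x)
      from-positions (a , b , a<b , b< , _ , same , refl) = resp a b a<b b< same

  EdgesBelow-pairsOf : ∀ n p G → (∀ a → a < length G → G ‼ a < n) → EdgesBelow n (pairsOf (zip p G))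
  EdgesBelow-pairsOf n p G G< = All.tabulate λ x∈ → from-positions (∈-pairsOf⁻ 0 p G x∈)
    where
      from-positions : ∀ {x} → (∃ λ a → ∃ λ b → a < b × b < length p × b < length G × p ‼ a ≡ p ‼ b × x ≡ (G ‼ a , G ‼ b)) →
                       proj₁ x < n × proj₂ x < n
      from-positions (a , b , a<b , _ , b< , _ , refl) = G< a (<-trans a<b b<) , G< b b<

  isStarOne : Eps → Eps → Bool
  isStarOne star one = true
  isStarOne _    _   = false

  isStarOne⇒ : ∀ {x y} → isStarOne x y ≡ true → x ≡ star × y ≡ one
  isStarOne⇒ {star} {one} _ = refl , refl

  star≢one : star ≢ one
  star≢one ()

  letterOf : Pow → Eps
  letterOf pstar  = star
  letterOf (pw _) = one

  letters : List Pow → List Eps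
  letters ks = concatMap word ks

  factorIndices : ℕ → List Pow → List ℕ
  factorIndices o []       = []
  factorIndices o (k ∷ ks) = replicate (length (word k)) o ++ factorIndices (suc o) ks

  factorOf : List Pow → List ℕ
  factorOf = factorIndices 0

  length-factorIndices : ∀ o ks → length (factorIndices o ks) ≡ length (letters ks)
  length-factorIndices o []       = refl
  length-factorIndices o (k ∷ ks) = begin
    length (replicate (length (word k)) o ++ factorIndices (suc o) ks)   ≡⟨ ListP.length-++ (replicate (length (word k)) o) ⟩
    length (replicate (length (word k)) o) + length (factorIndices (suc o) ks)
      ≡⟨ cong₂ _+_ (ListP.length-replicate (length (word k))) (length-factorIndices (suc o) ks) ⟩
    length (word k) + length (letters ks)                                 ≡⟨ sym (ListP.length-++ (word k)) ⟩
    length (word k ++ letters ks)                                          ∎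
    where open ≡-Reasoning

  letters-stars : ∀ m ks → letters (replicate m pstar ++ ks) ≡ replicate m star ++ letters ks
  letters-stars zero    ks = refl
  letters-stars (suc m) ks = cong (star ∷_) (letters-stars m ks)

  letters-ones : ∀ m → letters (replicate m (pw 1)) ≡ replicate m one
  letters-ones zero    = refl
  letters-ones (suc m) = cong (one ∷_) (letters-ones m)

  at-word : ∀ k a → a < length (word k) → at star (word k) a ≡ letterOf k
  at-word pstar  zero    _         = refl
  at-word pstar  (suc a) (s≤s ())
  at-word (pw K) a       a< = at-replicate star one K a (subst (a <_) (ListP.length-replicate K) a<)

  ∸≡suc[∸suc] : ∀ o g → suc o ≤ g → g ∸ o ≡ suc (g ∸ suc o)
  ∸≡suc[∸suc] zero    (suc g) _         = refl
  ∸≡suc[∸suc] (suc o) (suc g) (s≤s o<g) = ∸≡suc[∸suc] o g o<g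

  factorIndices-at : ∀ o ks a → a < length (letters ks) →
    o ≤ factorIndices o ks ‼ a × factorIndices o ks ‼ a < o + length ks ×
    at star (letters ks) a ≡ letterOf (at (pw 0) ks (factorIndices o ks ‼ a ∸ o))
  factorIndices-at o (k ∷ ks) a a<
    with at-++-cases star (word k) (letters ks) a a<
       | at-++-cases 0 (replicate ℓ o) (factorIndices (suc o) ks) a (subst (a <_) (sym (length-factorIndices o (k ∷ ks))) a<)
    where ℓ = length (word k)
  ... | inj₁ (a<k , ea) | inj₁ (_ , fa) = ≤-reflexive (sym fa≡o) , o<o+1+ , trans ea (trans (at-word k a a<k) first-factor)
    where
      fa≡o : factorIndices o (k ∷ ks) ‼ a ≡ o
      fa≡o = trans fa (at-replicate 0 o (length (word k)) a a<k)
      o<o+1+ : factorIndices o (k ∷ ks) ‼ a < o + suc (length ks)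
      o<o+1+ = subst (_< o + suc (length ks)) (sym fa≡o) (subst (o <_) (sym (+-suc o (length ks))) (s≤s (m≤m+n o (length ks))))
      first-factor : letterOf k ≡ letterOf (at (pw 0) (k ∷ ks) (factorIndices o (k ∷ ks) ‼ a ∸ o))
      first-factor = cong (λ u → letterOf (at (pw 0) (k ∷ ks) u)) (sym (trans (cong (_∸ o) fa≡o) (n∸n≡0 o)))
  ... | inj₁ (a<k , _) | inj₂ (k≤a , _) =
    ⊥-elim (<-irrefl refl (<-≤-trans a<k (subst (_≤ a) (ListP.length-replicate (length (word k))) k≤a)))
  ... | inj₂ (k≤a , _) | inj₁ (a<k , _) =
    ⊥-elim (<-irrefl refl (<-≤-trans (subst (a <_) (ListP.length-replicate (length (word k))) a<k) k≤a))
  ... | inj₂ (_ , a′< , ea) | inj₂ (_ , _ , fa) with factorIndices-at (suc o) ks (a ∸ length (word k)) a′<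
  ...   | o<f , f< , ea′ =
    ≤-trans (n≤1+n o) o<fa ,
    subst (_< o + suc (length ks)) (sym fa≡) (subst (factorIndices (suc o) ks ‼ (a ∸ length (word k)) <_) (sym (+-suc o (length ks))) f<) ,
    trans ea (trans ea′ (trans (cong (λ u → letterOf (at (pw 0) ks (u ∸ suc o))) (sym fa≡))
                               (cong (λ u → letterOf (at (pw 0) (k ∷ ks) u)) (sym (∸≡suc[∸suc] o _ o<fa)))))
    where
      fa≡ : factorIndices o (k ∷ ks) ‼ a ≡ factorIndices (suc o) ks ‼ (a ∸ length (word k))
      fa≡ = trans fa (cong (λ u → factorIndices (suc o) ks ‼ (a ∸ u)) (ListP.length-replicate (length (word k))))
      o<fa : suc o ≤ factorIndices o (k ∷ ks) ‼ a
      o<fa = subst (suc o ≤_) (sym fa≡) o<f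

  factorIndices-monotone : ∀ o ks a b → a ≤ b → b < length (letters ks) → factorIndices o ks ‼ a ≤ factorIndices o ks ‼ b
  factorIndices-monotone o (k ∷ ks) a b a≤b b<
    with at-++-cases 0 (replicate ℓ o) (factorIndices (suc o) ks) a (≤-<-trans a≤b b<′)
       | at-++-cases 0 (replicate ℓ o) (factorIndices (suc o) ks) b b<′
    where
      ℓ = length (word k)
      b<′ : b < length (replicate ℓ o ++ factorIndices (suc o) ks)
      b<′ = subst (b <_) (sym (length-factorIndices o (k ∷ ks))) b<
  ... | inj₁ (a<k , fa) | _ =
    subst (_≤ factorIndices o (k ∷ ks) ‼ b) (sym (trans fa (at-replicate 0 o (length (word k)) a a<ℓ)))
          (proj₁ (factorIndices-at o (k ∷ ks) b b<))
    where a<ℓ = subst (a <_) (ListP.length-replicate (length (word k))) a<k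
  ... | inj₂ (k≤a , _ , _) | inj₁ (b<k , _) = ⊥-elim (<-irrefl refl (<-≤-trans b<k (≤-trans k≤a a≤b)))
  ... | inj₂ (_ , _ , fa) | inj₂ (_ , b′< , fb) = subst₂ _≤_ (sym fa) (sym fb)
    (factorIndices-monotone (suc o) ks (a ∸ ℓ′) (b ∸ ℓ′) (∸-monoˡ-≤ ℓ′ a≤b) (subst (b ∸ ℓ′ <_) (length-factorIndices (suc o) ks) b′<))
    where ℓ′ = length (replicate (length (word k)) o)

  count-factorIndices : ∀ o ks g → o ≤ g → count g (factorIndices o ks) ≡ length (word (at (pw 0) ks (g ∸ o)))
  count-factorIndices o []       g _   = refl
  count-factorIndices o (k ∷ ks) g o≤g with m≤n⇒m<n∨m≡n o≤g
  ... | inj₂ refl = begin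
    count o (replicate ℓ o ++ factorIndices (suc o) ks)              ≡⟨ count-++ o (replicate ℓ o) _ ⟩
    count o (replicate ℓ o) + count o (factorIndices (suc o) ks)     ≡⟨ cong₂ _+_ (count-replicate-self o ℓ) none-later ⟩
    ℓ + 0                                                             ≡⟨ +-identityʳ ℓ ⟩
    ℓ                                                                 ≡⟨ cong (λ u → length (word (at (pw 0) (k ∷ ks) u))) (sym (n∸n≡0 o)) ⟩
    length (word (at (pw 0) (k ∷ ks) (o ∸ o)))                        ∎
    where
      open ≡-Reasoning
      ℓ = length (word k)
      none-later : count o (factorIndices (suc o) ks) ≡ 0
      none-later = count-absent o (factorIndices (suc o) ks) λ i i< e →
        <-irrefl (sym e) (proj₁ (factorIndices-at (suc o) ks i (subst (i <_) (length-factorIndices (suc o) ks) i<)))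
  ... | inj₁ o<g = begin
    count g (replicate ℓ o ++ factorIndices (suc o) ks)              ≡⟨ count-++ g (replicate ℓ o) _ ⟩
    count g (replicate ℓ o) + count g (factorIndices (suc o) ks)
      ≡⟨ cong₂ _+_ (count-replicate-other g o ℓ (<⇒≢ o<g)) (count-factorIndices (suc o) ks g o<g) ⟩
    length (word (at (pw 0) ks (g ∸ suc o)))
      ≡⟨ cong (λ u → length (word (at (pw 0) (k ∷ ks) u))) (sym (∸≡suc[∸suc] o g o<g)) ⟩
    length (word (at (pw 0) (k ∷ ks) (g ∸ o)))                        ∎
    where
      open ≡-Reasoning
      ℓ = length (word k)

  factorIndices-singletons : ∀ o ks → All (λ k → length (word k) ≡ 1) ks → ∀ a → a < length ks → factorIndices o ks ‼ a ≡ o + a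
  factorIndices-singletons o (k ∷ ks) (ℓ≡1 ∷ _) zero _ rewrite ℓ≡1 = sym (+-identityʳ o)
  factorIndices-singletons o (k ∷ ks) (ℓ≡1 ∷ ℓs≡1) (suc a) (s≤s a<) rewrite ℓ≡1 =
    trans (factorIndices-singletons (suc o) ks ℓs≡1 a a<) (sym (+-suc o a))

  zip-++ : {X Y : Set} (xs : List X) (us : List Y) (ys : List X) (vs : List Y) → length xs ≡ length us →
           zip (xs ++ ys) (us ++ vs) ≡ zip xs us ++ zip ys vs
  zip-++ []       []       ys vs _ = refl
  zip-++ (x ∷ xs) (u ∷ us) ys vs e = cong ((x , u) ∷_) (zip-++ xs us ys vs (suc-injective e))

  map-pair-replicate : {X Y : Set} (xs : List X) (y : Y) → map (λ e → e , y) xs ≡ zip xs (replicate (length xs) y)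
  map-pair-replicate []       y = refl
  map-pair-replicate (x ∷ xs) y = cong ((x , y) ∷_) (map-pair-replicate xs y)

  colour-factors : (c : ℕ → ℕ) (σ : List ℕ) (ks : List Pow) (o : ℕ) → length σ ≡ length ks → (∀ i → c (o + i) ≡ σ ‼ i) →
    concatMap (λ p → map (λ e → e , suc (proj₁ p)) (word (proj₂ p))) (zip σ ks) ≡
    zip (letters ks) (map (λ g → suc (c g)) (factorIndices o ks))
  colour-factors c []      []       o _ _ = refl
  colour-factors c (s ∷ σ) (k ∷ ks) o e c≡ = begin
    map (λ e → e , suc s) (word k) ++ concatMap (λ p → map (λ e → e , suc (proj₁ p)) (word (proj₂ p))) (zip σ ks)
      ≡⟨ cong₂ _++_ (map-pair-replicate (word k) (suc s))
                    (colour-factors c σ ks (suc o) (suc-injective e) (λ i → trans (cong c (sym (+-suc o i))) (c≡ (suc i)))) ⟩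
    zip (word k) (replicate ℓ (suc s)) ++ zip (letters ks) (map f (factorIndices (suc o) ks))
      ≡⟨ cong (λ z → zip (word k) z ++ zip (letters ks) (map f (factorIndices (suc o) ks))) (sym f-first) ⟩
    zip (word k) (map f (replicate ℓ o)) ++ zip (letters ks) (map f (factorIndices (suc o) ks))
      ≡⟨ sym (zip-++ (word k) (map f (replicate ℓ o)) (letters ks) (map f (factorIndices (suc o) ks)) ℓ≡) ⟩
    zip (word k ++ letters ks) (map f (replicate ℓ o) ++ map f (factorIndices (suc o) ks))
      ≡⟨ cong (zip (word k ++ letters ks)) (sym (ListP.map-++ f (replicate ℓ o) (factorIndices (suc o) ks))) ⟩
    zip (word k ++ letters ks) (map f (replicate ℓ o ++ factorIndices (suc o) ks)) ∎
    where
      open ≡-Reasoning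
      ℓ = length (word k)
      f = λ g → suc (c g)
      f-first : map f (replicate ℓ o) ≡ replicate ℓ (suc s)
      f-first = trans (ListP.map-replicate f ℓ o) (cong (λ z → replicate ℓ (suc z)) (trans (cong c (sym (+-identityʳ o))) (c≡ 0)))
      ℓ≡ : length (word k) ≡ length (map f (replicate ℓ o))
      ℓ≡ = sym (trans (ListP.length-map f (replicate ℓ o)) (ListP.length-replicate ℓ))

  -- Permutations of [m] as lists of values, and the pair partitions π_σ

  record IsPerm (m : ℕ) (σ : List ℕ) : Set where
    constructor isPerm
    field
      length≡   : length σ ≡ m
      bounded   : ∀ i → i < m → σ ‼ i < m
      injective : InjectiveBelow m (σ ‼_)

  IsPerm-surjective : ∀ {m σ} → IsPerm m σ → ∀ y → y < m → ∃ λ i → i < m × σ ‼ i ≡ y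
  IsPerm-surjective {m} {σ} (isPerm _ σ< inj) = injective⇒surjective m (σ ‼_) σ< inj

  upTo-IsPerm : ∀ m → IsPerm m (upTo m)
  upTo-IsPerm m = isPerm (ListP.length-upTo m) (λ i i< → subst (_< m) (sym (at-upTo m i i<)) i<)
                         (λ i j i< j< e → trans (sym (at-upTo m i i<)) (trans e (at-upTo m j j<)))

  IsPerm⇒count≡1 : ∀ {m σ} → IsPerm m σ → ∀ l → l < m → count l σ ≡ 1
  IsPerm⇒count≡1 {σ = σ} perm@(isPerm refl _ inj) l l< with IsPerm-surjective perm l l<
  ... | i , i< , σi≡l = count-unique l σ (λ a b a< b< ea eb → inj a b a< b< (trans ea (sym eb))) i i< σi≡l

  indexOf-first : ∀ x xs i → i < length xs → xs ‼ i ≡ x → (∀ i′ → i′ < i → xs ‼ i′ ≢ x) → indexOf x xs ≡ i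
  indexOf-first x (y ∷ ys) zero    _        refl _     rewrite ≡ᵇ-refl x = refl
  indexOf-first x (y ∷ ys) (suc i) (s≤s i<) e    first rewrite ≢⇒≡ᵇ-false x y (λ x≡y → first 0 z<s (sym x≡y)) =
    cong suc (indexOf-first x ys i i< e (λ i′ i′< → first (suc i′) (s≤s i′<)))

  indexOf-found : ∀ x xs i → i < length xs → xs ‼ i ≡ x → indexOf x xs < length xs × xs ‼ indexOf x xs ≡ x
  indexOf-found x (y ∷ ys) i i< e with x ≡ᵇ y in x≡ᵇy
  ... | true = z<s , sym (≡ᵇ-true⇒≡ x y x≡ᵇy)
  indexOf-found x (y ∷ ys) zero    _        e | false = ⊥-elim (≡ᵇ-false⇒≢ x y x≡ᵇy (sym e))
  indexOf-found x (y ∷ ys) (suc i) (s≤s i<) e | false with indexOf-found x ys i i< e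
  ... | found< , found = s≤s found< , found

  module _ {m σ} (perm : IsPerm m σ) where

    indexOf-< : ∀ j → j < m → indexOf j σ < m
    indexOf-< j j< with IsPerm-surjective perm j j<
    ... | i , i< , e = subst (indexOf j σ <_) (IsPerm.length≡ perm) (proj₁ (indexOf-found j σ i (subst (i <_) (sym (IsPerm.length≡ perm)) i<) e))

    at-indexOf : ∀ j → j < m → σ ‼ indexOf j σ ≡ j
    at-indexOf j j< with IsPerm-surjective perm j j<
    ... | i , i< , e = proj₂ (indexOf-found j σ i (subst (i <_) (sym (IsPerm.length≡ perm)) i<) e)

    indexOf-at : ∀ i → i < m → indexOf (σ ‼ i) σ ≡ i
    indexOf-at i i< = indexOf-first (σ ‼ i) σ i (subst (i <_) (sym (IsPerm.length≡ perm)) i<) refl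
      (λ i′ i′<i e → <-irrefl (IsPerm.injective perm i′ i (<-trans i′<i i<) i< e) i′<i)

  inverse : ℕ → List ℕ → List ℕ
  inverse m σ = map (λ j → indexOf j σ) (upTo m)

  length-inverse : ∀ m σ → length (inverse m σ) ≡ m
  length-inverse m σ = trans (ListP.length-map _ (upTo m)) (ListP.length-upTo m)

  at-inverse : ∀ m σ j → j < m → inverse m σ ‼ j ≡ indexOf j σ
  at-inverse m σ j j< = trans (at-map (λ j → indexOf j σ) 0 0 (upTo m) j (subst (j <_) (sym (ListP.length-upTo m)) j<))
                              (cong (λ u → indexOf u σ) (at-upTo m j j<))

  inverse-IsPerm : ∀ {m σ} → IsPerm m σ → IsPerm m (inverse m σ)
  inverse-IsPerm {m} {σ} perm = isPerm (length-inverse m σ) inverse< inverse-inj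
    where
      inverse< : ∀ j → j < m → inverse m σ ‼ j < m
      inverse< j j< = subst (_< m) (sym (at-inverse m σ j j<)) (indexOf-< perm j j<)
      inverse-inj : InjectiveBelow m (inverse m σ ‼_)
      inverse-inj i j i< j< e = begin
        i                     ≡⟨ sym (at-indexOf perm i i<) ⟩
        σ ‼ indexOf i σ       ≡⟨ cong (σ ‼_) (trans (sym (at-inverse m σ i i<)) (trans e (at-inverse m σ j j<))) ⟩
        σ ‼ indexOf j σ       ≡⟨ at-indexOf perm j j< ⟩
        j                     ∎
        where open ≡-Reasoning

  indexOf-inverse : ∀ {m σ} → IsPerm m σ → ∀ j → j < m → indexOf j (inverse m σ) ≡ σ ‼ j
  indexOf-inverse {m} {σ} perm j j< = begin
    indexOf j (inverse m σ)                       ≡⟨ cong (λ u → indexOf u (inverse m σ)) (sym inverse-at-σj) ⟩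
    indexOf (inverse m σ ‼ (σ ‼ j)) (inverse m σ) ≡⟨ indexOf-at (inverse-IsPerm perm) (σ ‼ j) σj< ⟩
    σ ‼ j                                         ∎
    where
      open ≡-Reasoning
      σj< = IsPerm.bounded perm j j<
      inverse-at-σj : inverse m σ ‼ (σ ‼ j) ≡ j
      inverse-at-σj = trans (at-inverse m σ (σ ‼ j) σj<) (indexOf-at perm j j<)

  inverse-involutive : ∀ {m σ} → IsPerm m σ → inverse m (inverse m σ) ≡ σ
  inverse-involutive {m} {σ} perm = at-ext 0 (inverse m (inverse m σ)) σ (trans (length-inverse m (inverse m σ)) (sym (IsPerm.length≡ perm))) λ j j< →
    let j<m = subst (j <_) (length-inverse m (inverse m σ)) j<
    in trans (at-inverse m (inverse m σ) j j<m) (indexOf-inverse perm j j<m)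

  inverse-injective : ∀ {m σ σ′} → IsPerm m σ → IsPerm m σ′ → inverse m σ ≡ inverse m σ′ → σ ≡ σ′
  inverse-injective {m} perm perm′ e =
    trans (sym (inverse-involutive perm)) (trans (cong (inverse m) e) (inverse-involutive perm′))

  length-piSigma : ∀ m σ → length (piSigma m σ) ≡ m + m
  length-piSigma m σ = trans (ListP.length-++ (upTo m)) (cong₂ _+_ (ListP.length-upTo m) (length-inverse m σ))

  piSigma-at-first : ∀ m σ a → a < m → piSigma m σ ‼ a ≡ a
  piSigma-at-first m σ a a< = trans (at-++ˡ 0 (upTo m) _ a (subst (a <_) (sym (ListP.length-upTo m)) a<)) (at-upTo m a a<)

  piSigma-at-second : ∀ m σ j → piSigma m σ ‼ (m + j) ≡ inverse m σ ‼ j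
  piSigma-at-second m σ j = trans (cong (λ u → piSigma m σ ‼ (u + j)) (sym (ListP.length-upTo m))) (at-++ʳ 0 (upTo m) _ j)

  piSigma-injective : ∀ {m σ σ′} → IsPerm m σ → IsPerm m σ′ → piSigma m σ ≡ piSigma m σ′ → σ ≡ σ′
  piSigma-injective {m} perm perm′ e = inverse-injective perm perm′ (ListP.++-cancelˡ (upTo m) _ _ e)

  CrossesMiddle : ℕ → List ℕ → Set
  CrossesMiddle m π = ∀ a b → a < b → b < m + m → π ‼ a ≡ π ‼ b → a < m × m ≤ b

  count≡2⇒isPair : ∀ π → (∀ l → l < numBlocks π → count l π ≡ 2) → isPair π ≡ true
  count≡2⇒isPair π two = at-allB 0 _ (upTo (numBlocks π)) λ l l< →
    let l<π = subst (l <_) (ListP.length-upTo (numBlocks π)) l<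
    in subst (λ u → (count u π ≡ᵇ 2) ≡ true) (sym (at-upTo (numBlocks π) l l<π)) (subst (λ c → (c ≡ᵇ 2) ≡ true) (sym (two l l<π)) refl)

  split-second-half : ∀ m a → m ≤ a → a < m + m → a ≡ m + (a ∸ m) × a ∸ m < m
  split-second-half m a m≤a a< = sym (m+[n∸m]≡n m≤a) , +-cancelˡ-< m _ _ (subst (_< m + m) (sym (m+[n∸m]≡n m≤a)) a<)

  piSigma-crossing-pairing : ∀ {m σ} → IsPerm m σ →
    RGS (m + m) (piSigma m σ) × isPair (piSigma m σ) ≡ true × CrossesMiddle m (piSigma m σ)
  piSigma-crossing-pairing {m} {σ} perm = isRGS , count≡2⇒isPair π two , crosses
    where
      π = piSigma m σ
      τ-perm = inverse-IsPerm perm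
      τ< : ∀ j → j < length (inverse m σ) → inverse m σ ‼ j < numBlocks (upTo m)
      τ< j j< = subst (inverse m σ ‼ j <_) (sym (numBlocks-upTo m)) (IsPerm.bounded τ-perm j (subst (j <_) (length-inverse m σ) j<))
      isRGS : RGS (m + m) π
      isRGS = subst (λ u → RGS (m + u) π) (length-inverse m σ) (RGS-++ (RGS-upTo m) (inverse m σ) τ<)
      numBlocks≡m : numBlocks π ≡ m
      numBlocks≡m = trans (numBlocks-++ (upTo m) (inverse m σ))
        (trans (cong (_⊔ numBlocks (inverse m σ)) (numBlocks-upTo m))
               (m≥n⇒m⊔n≡m (numBlocks-≤ m (inverse m σ) (λ j j< → subst (inverse m σ ‼ j <_) (numBlocks-upTo m) (τ< j j<)))))
      two : ∀ l → l < numBlocks π → count l π ≡ 2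
      two l l< = let l<m = subst (l <_) numBlocks≡m l< in
        trans (count-++ l (upTo m) (inverse m σ))
              (cong₂ _+_ (IsPerm⇒count≡1 (upTo-IsPerm m) l l<m) (IsPerm⇒count≡1 τ-perm l l<m))
      crosses : CrossesMiddle m π
      crosses a b a<b b< same with a <? m | b <? m
      ... | _       | yes b<m = ⊥-elim (<-irrefl (trans (sym (piSigma-at-first m σ a (<-trans a<b b<m)))
                                                         (trans same (piSigma-at-first m σ b b<m))) a<b)
      ... | yes a<m | no  b≮m = a<m , ≮⇒≥ b≮m
      ... | no  a≮m | no  b≮m with split-second-half m a (≮⇒≥ a≮m) (<-trans a<b b<) | split-second-half m b (≮⇒≥ b≮m) b<
      ...   | a≡ , a′< | b≡ , b′< = ⊥-elim (<-irrefl a′≡b′ (+-cancelˡ-< m _ _ (subst₂ _<_ a≡ b≡ a<b)))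
        where
          a′≡b′ : a ∸ m ≡ b ∸ m
          a′≡b′ = IsPerm.injective τ-perm (a ∸ m) (b ∸ m) a′< b′<
            (trans (sym (piSigma-at-second m σ (a ∸ m)))
                   (trans (cong (π ‼_) (sym a≡)) (trans same (trans (cong (π ‼_) b≡) (piSigma-at-second m σ (b ∸ m))))))

  ∈-seqs⁻ : ∀ k m {σ} → σ ∈ seqs k m → length σ ≡ k × (∀ i → i < k → σ ‼ i < m)
  ∈-seqs⁻ zero    m (here refl) = refl , λ i ()
  ∈-seqs⁻ (suc k) m σ∈ with find (∈-concatMap⁻ (λ c → map (c ∷_) (seqs k m)) {xs = upTo m} σ∈)
  ... | c , c∈ , cτ∈ with ∈-map⁻ (c ∷_) cτ∈
  ...   | τ , τ∈ , refl with ∈-seqs⁻ k m τ∈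
  ...     | τ-length , τ< = cong suc τ-length , λ where
              zero    _        → ∈-upTo⁻ c∈
              (suc i) (s≤s i<) → τ< i i<

  anyB-≡ᵇ-false⇒absent : ∀ x xs → anyB (λ y → x ≡ᵇ y) xs ≡ false → ∀ i → i < length xs → xs ‼ i ≢ x
  anyB-≡ᵇ-false⇒absent x (y ∷ ys) h i i< e with x ≡ᵇ y in x≡ᵇy
  anyB-≡ᵇ-false⇒absent x (y ∷ ys) h zero    _        e | false = ≡ᵇ-false⇒≢ x y x≡ᵇy (sym e)
  anyB-≡ᵇ-false⇒absent x (y ∷ ys) h (suc i) (s≤s i<) e | false = anyB-≡ᵇ-false⇒absent x ys h i i< e

  absent⇒anyB-≡ᵇ-false : ∀ x xs → (∀ i → i < length xs → xs ‼ i ≢ x) → anyB (λ y → x ≡ᵇ y) xs ≡ false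
  absent⇒anyB-≡ᵇ-false x []       _      = refl
  absent⇒anyB-≡ᵇ-false x (y ∷ ys) absent rewrite ≢⇒≡ᵇ-false x y (λ e → absent 0 z<s (sym e)) =
    absent⇒anyB-≡ᵇ-false x ys (λ i i< → absent (suc i) (s≤s i<))

  noDup⇒injective : ∀ σ → noDup σ ≡ true → InjectiveBelow (length σ) (σ ‼_)
  noDup⇒injective (x ∷ σ) h zero    zero    _        _        _ = refl
  noDup⇒injective (x ∷ σ) h zero    (suc j) _        (s≤s j<) e =
    ⊥-elim (anyB-≡ᵇ-false⇒absent x σ (not-true (proj₁ (∧-elim h))) j j< (sym e))
  noDup⇒injective (x ∷ σ) h (suc i) zero    (s≤s i<) _        e =
    ⊥-elim (anyB-≡ᵇ-false⇒absent x σ (not-true (proj₁ (∧-elim h))) i i< e)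
  noDup⇒injective (x ∷ σ) h (suc i) (suc j) (s≤s i<) (s≤s j<) e = cong suc (noDup⇒injective σ (proj₂ (∧-elim h)) i j i< j< e)

  injective⇒noDup : ∀ σ → InjectiveBelow (length σ) (σ ‼_) → noDup σ ≡ true
  injective⇒noDup []      _   = refl
  injective⇒noDup (x ∷ σ) inj rewrite absent⇒anyB-≡ᵇ-false x σ (λ i i< e → 0≢1+n (inj 0 (suc i) z<s (s≤s i<) (sym e))) =
    injective⇒noDup σ (λ i j i< j< e → suc-injective (inj (suc i) (suc j) (s≤s i<) (s≤s j<) e))

  IsPerm⇒noDup : ∀ {m σ} → IsPerm m σ → noDup σ ≡ true
  IsPerm⇒noDup {σ = σ} (isPerm refl _ inj) = injective⇒noDup σ inj

  ∈-perms⁻ : ∀ m {σ} → σ ∈ perms m → IsPerm m σ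
  ∈-perms⁻ m {σ} σ∈ with ∈-filter⁻ (λ s → noDup s Bool.≟ true) {xs = seqs m m} σ∈
  ... | σ∈seqs , nd with ∈-seqs⁻ m m σ∈seqs
  ...   | refl , σ< = isPerm refl σ< (noDup⇒injective σ nd)

  at-drop : ∀ k (xs : List ℕ) j → drop k xs ‼ j ≡ xs ‼ (k + j)
  at-drop zero    xs       j = refl
  at-drop (suc k) []       j = refl
  at-drop (suc k) (x ∷ xs) j = at-drop k xs j

  -- No two positions of the first half share a block, so each of them opens a new one.
  crossing-prefix : ∀ {m π} → RGS (m + m) π → CrossesMiddle m π → ∀ a → a < m → π ‼ a ≡ a
  crossing-prefix {m} {π} r cross a a< = below (suc a) a< a ≤-refl
    where
      below : ∀ a → a ≤ m → ∀ i → i < a → π ‼ i ≡ i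
      below (suc a) a≤ i i< with m<1+n⇒m<n∨m≡n i<
      ... | inj₁ i<a  = below a (≤-trans (n≤1+n a) a≤) i i<a
      ... | inj₂ refl = ≤-antisym π‼i≤i i≤π‼i
        where
          i<m : i < m
          i<m = a≤
          i<2m : i < m + m
          i<2m = <-≤-trans i<m (m≤m+n m m)
          i≤π = subst (i ≤_) (sym (RGS-length r)) (<⇒≤ i<2m)
          take-i : take i π ≡ upTo i
          take-i = at-ext 0 (take i π) (upTo i) (trans (length-take-≤ i π i≤π) (sym (ListP.length-upTo i))) λ k k< →
            let k<i = subst (k <_) (length-take-≤ i π i≤π) k<
            in trans (at-take i k π k<i) (trans (below i (<⇒≤ i<m) k k<i) (sym (at-upTo i k k<i)))
          π‼i≤i : π ‼ i ≤ i
          π‼i≤i = subst (π ‼ i ≤_) (trans (cong numBlocks take-i) (numBlocks-upTo i)) (RGS-bound r i i<2m)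
          i≤π‼i : i ≤ π ‼ i
          i≤π‼i with π ‼ i <? i
          ... | no  π‼i≮i = ≮⇒≥ π‼i≮i
          ... | yes π‼i<i = ⊥-elim (<-irrefl refl (<-≤-trans i<m
                              (proj₂ (cross (π ‼ i) i π‼i<i i<2m (below i (<⇒≤ i<m) (π ‼ i) π‼i<i)))))

  module _ {m π} (r : RGS (m + m) π) (pair : isPair π ≡ true) (cross : CrossesMiddle m π) where
    private
      π-length = RGS-length r
      prefix = crossing-prefix r cross
      m+j< : ∀ j → j < m → m + j < length π
      m+j< j j< = subst (m + j <_) (sym π-length) (+-monoʳ-< m j<)

      second-half-label : ∀ j → j < m → ∃ λ b → b < m × π ‼ (m + j) ≡ b
      second-half-label j j< with partner π (m + j) pair (m+j< j j<)
      ... | b , b< , b≢ , same with <-cmp b (m + j)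
      ...   | tri≈ _ b≡ _ = ⊥-elim (b≢ b≡)
      ...   | tri> _ _ b> = ⊥-elim (<-irrefl refl (<-≤-trans (proj₁ (cross (m + j) b b> (subst (b <_) π-length b<) (sym same)))
                                                               (m≤m+n m j)))
      ...   | tri< b<′ _ _ = b , b<m , trans (sym same) (prefix b b<m)
        where b<m = proj₁ (cross b (m + j) b<′ (subst (m + j <_) π-length (m+j< j j<)) same)

    crossing-second-half : IsPerm m (drop m π)
    crossing-second-half = isPerm (trans (ListP.length-drop m π) (trans (cong (_∸ m) π-length) (m+n∸m≡n m m))) τ< τ-inj
      where
        τ = drop m π
        τ< : ∀ j → j < m → τ ‼ j < m
        τ< j j< with second-half-label j j<
        ... | b , b<m , e = subst (_< m) (sym (trans (at-drop m π j) e)) b<m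
        τ-inj : InjectiveBelow m (τ ‼_)
        τ-inj j j′ j< j′< e = +-cancelˡ-≡ m j j′
            (partner-unique π v (m + j) (m + j′) pair (subst (v <_) (sym π-length) (<-≤-trans v<m (m≤m+n m m)))
              (m+j< j j<) (m+j< j′ j′<) (trans (sym (at-drop m π j)) (sym π‼v))
              (trans (sym (at-drop m π j′)) (trans (sym e) (sym π‼v))) (second≢ j) (second≢ j′))
          where
            v = τ ‼ j
            v<m = τ< j j<
            π‼v : π ‼ v ≡ v
            π‼v = prefix v v<m
            second≢ : ∀ k → m + k ≢ v
            second≢ k e′ = <-irrefl refl (<-≤-trans v<m (subst (m ≤_) e′ (m≤m+n m k)))

    crossing-first-half : take m π ≡ upTo m
    crossing-first-half = at-ext 0 (take m π) (upTo m) (trans (length-take-≤ m π m≤π) (sym (ListP.length-upTo m))) λ k k< →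
      let k<m = subst (k <_) (length-take-≤ m π m≤π) k<
      in trans (at-take m k π k<m) (trans (prefix k k<m) (sym (at-upTo m k k<m)))
      where m≤π = subst (m ≤_) (sym π-length) (m≤m+n m m)

  crossing-pairing⇒piSigma : ∀ m π → RGS (m + m) π → isPair π ≡ true → CrossesMiddle m π →
                             ∃ λ σ → IsPerm m σ × π ≡ piSigma m σ
  crossing-pairing⇒piSigma m π r pair cross = inverse m (drop m π) , inverse-IsPerm τ-perm , π≡
    where
      τ-perm = crossing-second-half r pair cross
      π≡ : π ≡ piSigma m (inverse m (drop m π))
      π≡ = begin
        π                                            ≡⟨ sym (ListP.take++drop≡id m π) ⟩
        take m π ++ drop m π                         ≡⟨ cong₂ _++_ (crossing-first-half r pair cross) (sym (inverse-involutive τ-perm)) ⟩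
        upTo m ++ inverse m (inverse m (drop m π))   ∎
        where open ≡-Reasoning

  -- Admissible pairings: every pair is an L* followed by an L

  admissible : List Eps → List ℕ → Bool
  admissible E p = allB (λ pr → isStarOne (proj₁ pr) (proj₂ pr)) (pairsOf (zip p E))

  Admissible : List Eps → List ℕ → Set
  Admissible E p = ∀ a b → a < b → b < length E → p ‼ a ≡ p ‼ b → at star E a ≡ star × at star E b ≡ one

  admissible⇒Admissible : ∀ E p → length p ≡ length E → admissible E p ≡ true → Admissible E p
  admissible⇒Admissible E p e h a b a<b b< same =
    isStarOne⇒ (allB-pairsOf⇒AllPairs star _ p E e h a b a<b (subst (b <_) (sym e) b<) same)

  Admissible⇒admissible : ∀ E p → length p ≡ length E → Admissible E p → admissible E p ≡ true
  Admissible⇒admissible E p e adm = AllPairs⇒allB-pairsOf star _ p E e λ a b a<b b< same →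
    star-one (adm a b a<b (subst (b <_) e b<) same)
    where
      star-one : ∀ {x y} → x ≡ star × y ≡ one → isStarOne x y ≡ true
      star-one (refl , refl) = refl

  letterOf≡star : ∀ k → letterOf k ≡ star → k ≡ pstar
  letterOf≡star pstar _ = refl

  letterOf≡one : ∀ k → letterOf k ≡ one → ∃ λ K → k ≡ pw K
  letterOf≡one (pw K) _ = K , refl

  sameColour : (ℕ → ℕ) → List ℕ → List ℕ → Bool
  sameColour col G p = allB (λ pr → col (proj₁ pr) ≡ᵇ col (proj₂ pr)) (pairsOf (zip p G))

  contracts : (Eps × ℕ) × (Eps × ℕ) → Bool
  contracts ((e , c) , (e′ , c′)) = isStarOne e e′ ∧ (c ≡ᵇ c′)

  allB-contracts : (E : List Eps) (G : List ℕ) (col : ℕ → ℕ) (p : List ℕ) → length E ≡ length G → length p ≡ length E →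
    allB contracts (pairsOf (zip p (zip E (map col G)))) ≡ (admissible E p ∧ sameColour col G p)
  allB-contracts E G col p E≡G p≡E = bool-ext to from
    where
      w = zip E (map col G)
      p≡G = trans p≡E E≡G
      E≡colG = trans E≡G (sym (ListP.length-map col G))
      p≡w : length p ≡ length w
      p≡w = trans p≡E (sym (length-zip E (map col G) E≡colG))
      at-w : ∀ a → a < length p → at (star , 0) w a ≡ (at star E a , col (G ‼ a))
      at-w a a< = trans (at-zip star 0 E (map col G) a E≡colG) (cong (at star E a ,_) (at-map col 0 0 G a (subst (a <_) p≡G a<)))
      to : allB contracts (pairsOf (zip p w)) ≡ true → (admissible E p ∧ sameColour col G p) ≡ true
      to h = ∧-intro (AllPairs⇒allB-pairsOf star _ p E p≡E (λ a b a<b b< same → proj₁ (∧-elim (good a b a<b b< same))))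
                     (AllPairs⇒allB-pairsOf 0 _ p G p≡G (λ a b a<b b< same → proj₂ (∧-elim (good a b a<b b< same))))
        where
          good : ∀ a b → a < b → b < length p → p ‼ a ≡ p ‼ b →
                 (isStarOne (at star E a) (at star E b) ∧ (col (G ‼ a) ≡ᵇ col (G ‼ b))) ≡ true
          good a b a<b b< same = subst₂ (λ u v → contracts (u , v) ≡ true) (at-w a (<-trans a<b b<)) (at-w b b<)
                                   (allB-pairsOf⇒AllPairs (star , 0) contracts p w p≡w h a b a<b b< same)
      from : (admissible E p ∧ sameColour col G p) ≡ true → allB contracts (pairsOf (zip p w)) ≡ true
      from h = AllPairs⇒allB-pairsOf (star , 0) contracts p w p≡w λ a b a<b b< same →
        subst₂ (λ u v → contracts (u , v) ≡ true) (sym (at-w a (<-trans a<b b<))) (sym (at-w b b<))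
          (∧-intro (allB-pairsOf⇒AllPairs star _ p E p≡E (proj₁ (∧-elim h)) a b a<b b< same)
                   (allB-pairsOf⇒AllPairs 0 _ p G p≡G (proj₂ (∧-elim h)) a b a<b b< same))

  module _ (E : List Eps) (p : List ℕ) (p-length : length p ≡ length E) (pair : isPair p ≡ true) (adm : Admissible E p) where

    star-paired-later : ∀ a → a < length E → at star E a ≡ star → ∃ λ b → a < b × b < length E × p ‼ a ≡ p ‼ b
    star-paired-later a a< Ea with partner p a pair (subst (a <_) (sym p-length) a<)
    ... | b , b< , b≢a , same with <-cmp b a
    ...   | tri≈ _ b≡a _ = ⊥-elim (b≢a b≡a)
    ...   | tri< b<a _ _ = ⊥-elim (star≢one (trans (sym Ea) (proj₂ (adm b a b<a a< same))))
    ...   | tri> _ _ a<b = b , a<b , subst (b <_) p-length b< , sym same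

    one-paired-earlier : ∀ a → a < length E → at star E a ≡ one → ∃ λ b → b < a × p ‼ b ≡ p ‼ a
    one-paired-earlier a a< Ea with partner p a pair (subst (a <_) (sym p-length) a<)
    ... | b , b< , b≢a , same with <-cmp b a
    ...   | tri≈ _ b≡a _ = ⊥-elim (b≢a b≡a)
    ...   | tri> _ _ a<b = ⊥-elim (star≢one (trans (sym (proj₁ (adm a b a<b (subst (b <_) p-length b<) (sym same)))) Ea))
    ...   | tri< b<a _ _ = b , b<a , same

    ones-unpaired : ∀ a b → a < length E → b < length E → at star E a ≡ one → at star E b ≡ one → p ‼ a ≡ p ‼ b → a ≡ b
    ones-unpaired a b a< b< Ea Eb same with <-cmp a b
    ... | tri≈ _ a≡b _ = a≡b
    ... | tri< a<b _ _ = ⊥-elim (star≢one (trans (sym (proj₁ (adm a b a<b b< same))) Ea))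
    ... | tri> _ _ b<a = ⊥-elim (star≢one (trans (sym (proj₁ (adm b a b<a a< (sym same)))) Eb))

  starsOnes : ℕ → ℕ → List Eps
  starsOnes m K = replicate m star ++ replicate K one

  length-starsOnes : ∀ m K → length (starsOnes m K) ≡ m + K
  length-starsOnes m K = trans (ListP.length-++ (replicate m star)) (cong₂ _+_ (ListP.length-replicate m) (ListP.length-replicate K))

  at-starsOnes-< : ∀ m K a → a < m → at star (starsOnes m K) a ≡ star
  at-starsOnes-< m K a a< =
    trans (at-++ˡ star (replicate m star) _ a (subst (a <_) (sym (ListP.length-replicate m)) a<)) (at-replicate star star m a a<)

  at-starsOnes-≥ : ∀ m K a → m ≤ a → a < m + K → at star (starsOnes m K) a ≡ one
  at-starsOnes-≥ m K a m≤a a< =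
    trans (at-++ʳ-∸ star (replicate m star) _ a (subst (_≤ a) (sym (ListP.length-replicate m)) m≤a))
          (at-replicate star one K _ (subst (λ u → a ∸ u < K) (sym (ListP.length-replicate m))
                                            (+-cancelˡ-< m _ _ (subst (_< m + K) (sym (m+[n∸m]≡n m≤a)) a<))))

  first-half≢ : ∀ {m} i b → i < m → i ≢ m + b
  first-half≢ {m} i b i<m e = <-irrefl e (<-≤-trans i<m (m≤m+n m b))

  -- Stars and ones are matched bijectively by the pairs, so both sides have the same size.
  module _ m K p (p-length : length p ≡ m + K) (pair : isPair p ≡ true) (adm : Admissible (starsOnes m K) p) where
    private
      E-length = length-starsOnes m K
      p-length′ : length p ≡ length (starsOnes m K)
      p-length′ = trans p-length (sym E-length)
      <E : ∀ {a} → a < m + K → a < length (starsOnes m K)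
      <E = subst (_ <_) (sym E-length)
      <p : ∀ {a} → a < m + K → a < length p
      <p = subst (_ <_) (sym p-length)

    starsOnes-balanced : K ≡ m
    starsOnes-balanced with <-cmp K m
    ... | tri≈ _ K≡m _ = K≡m
    ... | tri< K<m _ _ = ⊥-elim (pigeonhole-rel K m (λ i b → b < K × p ‼ (m + b) ≡ p ‼ i) K<m star-partner star-unique)
      where
        star-partner : ∀ i → i < m → ∃ λ b → b < K × (b < K × p ‼ (m + b) ≡ p ‼ i)
        star-partner i i<m with star-paired-later (starsOnes m K) p p-length′ pair adm i (<E (<-≤-trans i<m (m≤m+n m K))) (at-starsOnes-< m K i i<m)
        ... | c , i<c , c< , same with c <? m
        ...   | yes c<m = ⊥-elim (star≢one (trans (sym (at-starsOnes-< m K c c<m)) (proj₂ (adm i c i<c c< same))))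
        ...   | no  c≮m = c ∸ m , c∸m<K , c∸m<K , trans (cong (p ‼_) (m+[n∸m]≡n (≮⇒≥ c≮m))) (sym same)
          where
            c∸m<K : c ∸ m < K
            c∸m<K = +-cancelˡ-< m _ _ (subst (_< m + K) (sym (m+[n∸m]≡n (≮⇒≥ c≮m))) (subst (c <_) E-length c<))
        star-unique : ∀ i j b → i < m → j < m → (b < K × p ‼ (m + b) ≡ p ‼ i) → (b < K × p ‼ (m + b) ≡ p ‼ j) → i ≡ j
        star-unique i j b i<m j<m (b<K , ei) (_ , ej) =
          partner-unique p (m + b) i j pair (<p (+-monoʳ-< m b<K)) (<p (<-≤-trans i<m (m≤m+n m K))) (<p (<-≤-trans j<m (m≤m+n m K)))
            (sym ei) (sym ej) (first-half≢ i b i<m) (first-half≢ j b j<m)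
    ... | tri> _ _ m<K = ⊥-elim (pigeonhole-rel m K (λ i b → b < m × p ‼ b ≡ p ‼ (m + i)) m<K one-partner one-unique)
      where
        one-partner : ∀ i → i < K → ∃ λ b → b < m × (b < m × p ‼ b ≡ p ‼ (m + i))
        one-partner i i<K with one-paired-earlier (starsOnes m K) p p-length′ pair adm (m + i) (<E (+-monoʳ-< m i<K))
                                 (at-starsOnes-≥ m K (m + i) (m≤m+n m i) (+-monoʳ-< m i<K))
        ... | b , b< , same with b <? m
        ...   | yes b<m = b , b<m , b<m , same
        ...   | no  b≮m = ⊥-elim (star≢one (trans (sym (proj₁ (adm b (m + i) b< (<E (+-monoʳ-< m i<K)) same)))
                                                 (at-starsOnes-≥ m K b (≮⇒≥ b≮m) (<-trans b< (+-monoʳ-< m i<K)))))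
        one-unique : ∀ i j b → i < K → j < K → (b < m × p ‼ b ≡ p ‼ (m + i)) → (b < m × p ‼ b ≡ p ‼ (m + j)) → i ≡ j
        one-unique i j b i<K j<K (b<m , ei) (_ , ej) = +-cancelˡ-≡ m i j
          (partner-unique p b (m + i) (m + j) pair (<p (<-≤-trans b<m (m≤m+n m K))) (<p (+-monoʳ-< m i<K)) (<p (+-monoʳ-< m j<K))
            (sym ei) (sym ej) (λ e → first-half≢ b i b<m (sym e)) (λ e → first-half≢ b j b<m (sym e)))

  Admissible⇒CrossesMiddle : ∀ m p → Admissible (starsOnes m m) p → CrossesMiddle m p
  Admissible⇒CrossesMiddle m p adm a b a<b b< same with adm a b a<b (subst (b <_) (sym (length-starsOnes m m)) b<) same
  ... | Ea , Eb = a<m , m≤b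
    where
      a<m : a < m
      a<m with a <? m
      ... | yes a<m = a<m
      ... | no  a≮m = ⊥-elim (star≢one (trans (sym Ea) (at-starsOnes-≥ m m a (≮⇒≥ a≮m) (<-trans a<b b<))))
      m≤b : m ≤ b
      m≤b with b <? m
      ... | yes b<m = ⊥-elim (star≢one (trans (sym (at-starsOnes-< m m b b<m)) Eb))
      ... | no  b≮m = ≮⇒≥ b≮m

  CrossesMiddle⇒Admissible : ∀ m p → CrossesMiddle m p → Admissible (starsOnes m m) p
  CrossesMiddle⇒Admissible m p cross a b a<b b< same with cross a b a<b (subst (b <_) (length-starsOnes m m) b<) same
  ... | a<m , m≤b = at-starsOnes-< m m a a<m , at-starsOnes-≥ m m b m≤b (subst (b <_) (length-starsOnes m m) b<)

  piSigma-admissible : ∀ {m σ} → IsPerm m σ → isPair (piSigma m σ) ≡ true × admissible (starsOnes m m) (piSigma m σ) ≡ true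
  piSigma-admissible {m} {σ} perm with piSigma-crossing-pairing perm
  ... | _ , pair , cross = pair , Admissible⇒admissible (starsOnes m m) (piSigma m σ)
                                    (trans (length-piSigma m σ) (sym (length-starsOnes m m)))
                                    (CrossesMiddle⇒Admissible m (piSigma m σ) cross)

  -- The components of the factors joined by the pairs of a pairing

  factorOf< : ∀ ks a → a < length (factorOf ks) → factorOf ks ‼ a < length ks
  factorOf< ks a a< = proj₁ (proj₂ (factorIndices-at 0 ks a (subst (a <_) (length-factorIndices 0 ks) a<)))

  components : (ks : List Pow) (p : List ℕ) → GeneratedPartition (length ks) (pairsOf (zip p (factorOf ks)))
  components ks p = generatedPartition (length ks) _ (EdgesBelow-pairsOf (length ks) p (factorOf ks) (factorOf< ks))

  connectedComponents : List Pow → List ℕ → List ℕ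
  connectedComponents ks p = GeneratedPartition.labels (components ks p)

  sameColour≡refines : ∀ ks p σ → length σ ≡ length ks →
    sameColour (λ g → suc (σ ‼ g)) (factorOf ks) p ≡ refines (connectedComponents ks p) σ
  sameColour≡refines ks p σ σ-length = bool-ext
    (λ h → proj₂ (refines-generated⇔Respects E< (components ks p) σ σ-length)
                 (All.map (λ e → suc-injective (≡ᵇ-true⇒≡ _ _ e)) (allB⇒All _ _ h)))
    (λ h → All⇒allB _ _ (All.map (λ {x} e → subst (λ u → (σ ‼ proj₁ x ≡ᵇ u) ≡ true) e (≡ᵇ-refl (σ ‼ proj₁ x)))
                                 (proj₁ (refines-generated⇔Respects E< (components ks p) σ σ-length) h)))
    where E< = EdgesBelow-pairsOf (length ks) p (factorOf ks) (factorOf< ks)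

  length-letters-singletons : ∀ ks → All (λ k → length (word k) ≡ 1) ks → length (letters ks) ≡ length ks
  length-letters-singletons []       []              = refl
  length-letters-singletons (k ∷ ks) (ℓ≡1 ∷ singles) =
    trans (ListP.length-++ (word k)) (cong₂ _+_ ℓ≡1 (length-letters-singletons ks singles))

  connectedComponents-singletons : ∀ ks p → All (λ k → length (word k) ≡ 1) ks → RGS (length ks) p →
                                   connectedComponents ks p ≡ p
  connectedComponents-singletons ks p singletons rp =
    refines-antisym isRGS rp (refines-generated⇔ p (RGS-length rp) (refines-refl p))
                             (refines-generated⇐ γ (RGS-length isRGS) (refines-refl γ))
    where
      open GeneratedPartition (components ks p) renaming (labels to γ)
      N = length ks
      E< = EdgesBelow-pairsOf N p (factorOf ks) (factorOf< ks)
      G≡ : ∀ a → a < N → factorOf ks ‼ a ≡ a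
      G≡ = factorIndices-singletons 0 ks singletons
      p-length = RGS-length rp
      refines-generated⇔ : ∀ σ → length σ ≡ N → refines p σ ≡ true → refines γ σ ≡ true
      refines-generated⇔ σ σ-length h = proj₂ (refines-generated⇔Respects E< (components ks p) σ σ-length)
        (Respects-pairsOf⁺ (σ ‼_) p (factorOf ks) λ a b a<b b< same →
          let b<N = subst (b <_) p-length b< in
          subst₂ (λ u v → σ ‼ u ≡ σ ‼ v) (sym (G≡ a (<-trans a<b b<N))) (sym (G≡ b b<N))
                 (refines⇒Refines N p σ p-length σ-length h a b (<-trans a<b b<N) b<N same))
      refines-generated⇐ : ∀ σ → length σ ≡ N → refines γ σ ≡ true → refines p σ ≡ true
      refines-generated⇐ σ σ-length h = Refines⇒refines N p σ p-length σ-length λ i j i< j< same → by-order i j i< j< same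
        where
          σ-respects = proj₁ (refines-generated⇔Respects E< (components ks p) σ σ-length) h
          G-length : length p ≡ length (factorOf ks)
          G-length = trans p-length (sym (trans (length-factorIndices 0 ks) (length-letters-singletons ks singletons)))
          ordered : ∀ a b → a < b → b < N → p ‼ a ≡ p ‼ b → σ ‼ a ≡ σ ‼ b
          ordered a b a<b b<N same = subst₂ (λ u v → σ ‼ u ≡ σ ‼ v) (G≡ a (<-trans a<b b<N)) (G≡ b b<N)
            (Respects-pairsOf⁻ (σ ‼_) p (factorOf ks) G-length σ-respects a b a<b (subst (b <_) (sym p-length) b<N) same)
          by-order : ∀ i j → i < N → j < N → p ‼ i ≡ p ‼ j → σ ‼ i ≡ σ ‼ j
          by-order i j i< j< same with <-cmp i j
          ... | tri< i<j _ _ = ordered i j i<j j< same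
          ... | tri≈ _ refl _ = refl
          ... | tri> _ _ j<i = sym (ordered j i j<i i< (sym same))

  singletons-pattern : ∀ m → All (λ k → length (word k) ≡ 1) (replicate m pstar ++ replicate m (pw 1))
  singletons-pattern m = AllP.++⁺ (AllP.replicate⁺ m refl) (AllP.replicate⁺ m refl)
    where import Data.List.Relation.Unary.All.Properties as AllP

  letters-pairing-pattern : ∀ m → letters (replicate m pstar ++ replicate m (pw 1)) ≡ starsOnes m m
  letters-pairing-pattern m = trans (letters-stars m (replicate m (pw 1))) (cong (replicate m star ++_) (letters-ones m))

  -- Factors left unconnected by an admissible pairing

  module Disconnection (ys : List Pow) (y : Pow) (m : ℕ) (ys-length : length ys ≡ m) where

    ks : List Pow
    ks = ys ++ y ∷ []

    E : List Eps
    E = letters ks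

    G : List ℕ
    G = factorOf ks

    factor : ℕ → Pow
    factor = at (pw 0) ks

    ks-length : length ks ≡ suc m
    ks-length = trans (ListP.length-++ ys) (trans (+-comm (length ys) 1) (cong suc ys-length))

    factor-< : ∀ j → j < m → factor j ≡ at (pw 0) ys j
    factor-< j j< = at-++ˡ (pw 0) ys (y ∷ []) j (subst (j <_) (sym ys-length) j<)

    factor-last : factor m ≡ y
    factor-last = trans (cong factor (trans (sym ys-length) (sym (+-identityʳ (length ys))))) (at-++ʳ (pw 0) ys (y ∷ []) 0)

    G< : ∀ a → a < length E → G ‼ a < length ks
    G< a a< = proj₁ (proj₂ (factorIndices-at 0 ks a a<))

    E-at : ∀ a → a < length E → at star E a ≡ letterOf (factor (G ‼ a))
    E-at a a< = proj₂ (proj₂ (factorIndices-at 0 ks a a<))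

    letter-of-factor : ∀ g → 1 ≤ length (word (factor g)) → ∃ λ a → a < length E × G ‼ a ≡ g
    letter-of-factor g nonempty with occurrence g G (subst (1 ≤_) (sym (count-factorIndices 0 ks g z≤n)) nonempty)
    ... | a , a< , Ga = a , subst (a <_) (length-factorIndices 0 ks) a< , Ga

    star-letter-unique : ∀ a a′ → a < length E → a′ < length E → G ‼ a ≡ G ‼ a′ → factor (G ‼ a) ≡ pstar → a ≡ a′
    star-letter-unique a a′ a< a′< same star-factor with a ≟ a′
    ... | yes a≡a′ = a≡a′
    ... | no  a≢a′ = ⊥-elim (<-irrefl refl (≤-trans
          (count-≥2 (G ‼ a) G a a′ a≢a′ (<G a<) (<G a′<) refl (sym same))
          (≤-reflexive (trans (count-factorIndices 0 ks (G ‼ a) z≤n) (cong (λ k → length (word k)) star-factor)))))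
      where
        <G : ∀ {b} → b < length E → b < length G
        <G = subst (_ <_) (sym (length-factorIndices 0 ks))

    all-stars : (∀ j → j < m → factor j ≡ pstar) → ys ≡ replicate m pstar
    all-stars stars = at-ext (pw 0) ys (replicate m pstar) (trans ys-length (sym (ListP.length-replicate m))) λ j j< →
      let j<m = subst (j <_) ys-length j<
      in trans (sym (factor-< j j<m)) (trans (stars j j<m) (sym (at-replicate (pw 0) pstar m j j<m)))

    Disconnects : List ℕ → Set
    Disconnects p = Σ (ℕ → ℕ) λ s → (∀ a b → a < b → b < length E → p ‼ a ≡ p ‼ b → s (G ‼ a) ≡ s (G ‼ b)) ×
                    ∃ λ i → ∃ λ j → i < length ks × j < length ks × s i ≢ s j

    module _ (p : List ℕ) (p-length : length p ≡ length E) (pair : isPair p ≡ true) (adm : Admissible E p) where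

      <p : ∀ {c} → c < length E → c < length p
      <p = subst (_ <_) (sym p-length)

      last-not-star : y ≢ pstar
      last-not-star y≡ with letter-of-factor m (≤-reflexive (sym (cong (λ k → length (word k)) (trans factor-last y≡))))
      ... | a , a< , Ga with star-paired-later E p p-length pair adm a a< (trans (E-at a a<) (cong letterOf star-factor))
        where star-factor = trans (cong factor Ga) (trans factor-last y≡)
      ...   | b , a<b , b< , same = star≢one (trans (sym Eb) (proj₂ (adm a b a<b b< same)))
        where
          Gb≡m : G ‼ b ≡ m
          Gb≡m = ≤-antisym (≤-pred (subst (G ‼ b <_) ks-length (G< b b<)))
                           (subst (_≤ G ‼ b) Ga (factorIndices-monotone 0 ks a b (<⇒≤ a<b) b<))
          Eb : at star E b ≡ star
          Eb = trans (E-at b b<) (cong letterOf (trans (cong factor Gb≡m) (trans factor-last y≡)))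

      -- Factor j and the star factors paired into it get colour 1, everything else colour 0.
      module Colouring (j K′ K : ℕ) (j<m : j < m) (factor-j : factor j ≡ pw K′) (y≡ : y ≡ pw K) where

        Linked : ℕ → Set
        Linked i = ∃ λ a → a < length E × ∃ λ b → b < length E × G ‼ a ≡ i × p ‼ a ≡ p ‼ b × G ‼ b ≡ j

        linked? : ∀ i → Dec (Linked i)
        linked? i = search? (length E) _ λ a → search? (length E) _ λ b →
                      (G ‼ a ≟ i) ×-dec ((p ‼ a ≟ p ‼ b) ×-dec (G ‼ b ≟ j))

        s : ℕ → ℕ
        s i with i ≟ j | linked? i
        ... | yes _ | _     = 1
        ... | no  _ | yes _ = 1
        ... | no  _ | no  _ = 0

        s-one : ∀ i → i ≡ j ⊎ Linked i → s i ≡ 1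
        s-one i h with i ≟ j | linked? i
        ... | yes _   | _     = refl
        ... | no  _   | yes _ = refl
        ... | no  i≢j | no  _ with h
        ...   | inj₁ i≡j = ⊥-elim (i≢j i≡j)
        s-one i h | no _ | no ¬linked | inj₂ linked = ⊥-elim (¬linked linked)

        s-zero : ∀ i → i ≢ j → ¬ Linked i → s i ≡ 0
        s-zero i i≢j ¬linked with i ≟ j | linked? i
        ... | yes i≡j | _          = ⊥-elim (i≢j i≡j)
        ... | no  _   | yes linked = ⊥-elim (¬linked linked)
        ... | no  _   | no  _      = refl

        power-unlinked : ∀ i K″ → i ≢ j → factor i ≡ pw K″ → ¬ Linked i
        power-unlinked i K″ i≢j factor-i (a , a< , b , b< , Ga , same , Gb) =
          i≢j (trans (sym Ga) (trans (cong (G ‼_) (ones-unpaired E p p-length pair adm a b a< b<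
                 (one-at a a< (trans (cong factor Ga) factor-i)) (one-at b b< (trans (cong factor Gb) factor-j)) same)) Gb))
          where
            one-at : ∀ c → c < length E → ∀ {K‴} → factor (G ‼ c) ≡ pw K‴ → at star E c ≡ one
            one-at c c< fc = trans (E-at c c<) (cong letterOf fc)

        s-j≢s-m : s j ≢ s m
        s-j≢s-m e with trans (sym (s-one j (inj₁ refl))) (trans e (s-zero m m≢j (power-unlinked m K m≢j (trans factor-last y≡))))
          where m≢j = λ m≡j → <-irrefl (sym m≡j) j<m
        ... | ()

        s-respects : ∀ a b → a < b → b < length E → p ‼ a ≡ p ‼ b → s (G ‼ a) ≡ s (G ‼ b)
        s-respects a b a<b b< same with adm a b a<b b< same
        ... | Ea , Eb with letterOf≡star _ (trans (sym (E-at a (<-trans a<b b<))) Ea) | letterOf≡one _ (trans (sym (E-at b b<)) Eb)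
        ...   | factor-a | K″ , factor-b = by-cases (G ‼ b ≟ j)
          where
            Ga≢j : G ‼ a ≢ j
            Ga≢j e with trans (sym factor-a) (trans (cong factor e) factor-j)
            ... | ()
            Ga-unlinked : G ‼ b ≢ j → ¬ Linked (G ‼ a)
            Ga-unlinked Gb≢j (a′ , a′< , b′ , b′< , Ga′ , same′ , Gb′)
              with star-letter-unique a′ a a′< (<-trans a<b b<) Ga′ (trans (cong factor Ga′) factor-a)
            ... | refl with b′ ≟ a′
            ...   | yes refl = Ga≢j Gb′
            ...   | no  b′≢a = Gb≢j (trans (cong (G ‼_) (partner-unique p a′ b b′ pair (<p (<-trans a<b b<)) (<p b<) (<p b′<)
                                   (sym same) (sym same′) (λ e → <-irrefl (sym e) a<b) b′≢a)) Gb′)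
            by-cases : Dec (G ‼ b ≡ j) → s (G ‼ a) ≡ s (G ‼ b)
            by-cases (yes Gb≡j) = trans (s-one _ (inj₂ (a , <-trans a<b b< , b , b< , refl , same , Gb≡j))) (sym (s-one _ (inj₁ Gb≡j)))
            by-cases (no  Gb≢j) = trans (s-zero _ Ga≢j (Ga-unlinked Gb≢j)) (sym (s-zero _ Gb≢j (power-unlinked _ K″ Gb≢j factor-b)))

      power-factor-disconnects : ∀ j K′ K → j < m → factor j ≡ pw K′ → y ≡ pw K → Disconnects p
      power-factor-disconnects j K′ K j<m factor-j y≡ = s , s-respects , j , m , <-trans j<m m<n , m<n , s-j≢s-m
        where
          open Colouring j K′ K j<m factor-j y≡
          m<n : m < length ks
          m<n = subst (m <_) (sym ks-length) ≤-refl

      all-stars-balanced : ∀ K → (∀ j → j < m → factor j ≡ pstar) → y ≡ pw K → K ≡ m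
      all-stars-balanced K stars y≡ = starsOnes-balanced m K p (trans p-length (trans (cong length E≡) (length-starsOnes m K)))
                                        pair (subst (λ E′ → Admissible E′ p) E≡ adm)
        where
          E≡ : E ≡ starsOnes m K
          E≡ = begin
            letters (ys ++ y ∷ [])                           ≡⟨ cong₂ (λ u v → letters (u ++ v ∷ [])) (all-stars stars) y≡ ⟩
            letters (replicate m pstar ++ pw K ∷ [])         ≡⟨ letters-stars m (pw K ∷ []) ⟩
            replicate m star ++ (replicate K one ++ [])      ≡⟨ cong (replicate m star ++_) (ListP.++-identityʳ (replicate K one)) ⟩
            starsOnes m K                                    ∎
            where open ≡-Reasoning

      joined-to-last : (∀ j → j < m → factor j ≡ pstar) → (s : ℕ → ℕ) →
        (∀ a b → a < b → b < length E → p ‼ a ≡ p ‼ b → s (G ‼ a) ≡ s (G ‼ b)) → ∀ i → i < m → s i ≡ s m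
      joined-to-last stars s s-respects i i<m
        with letter-of-factor i (≤-reflexive (sym (cong (λ k → length (word k)) (stars i i<m))))
      ... | a , a< , Ga with star-paired-later E p p-length pair adm a a< (trans (E-at a a<) (cong letterOf (trans (cong factor Ga) (stars i i<m))))
      ...   | b , a<b , b< , same = trans (cong s (sym Ga)) (trans (s-respects a b a<b b< same) (cong s Gb≡m))
        where
          Gb≡m : G ‼ b ≡ m
          Gb≡m with G ‼ b <? m
          ... | yes Gb<m = ⊥-elim (star≢one (trans (sym (trans (E-at b b<) (cong letterOf (stars (G ‼ b) Gb<m)))) (proj₂ (adm a b a<b b< same))))
          ... | no  Gb≮m = ≤-antisym (≤-pred (subst (G ‼ b <_) ks-length (G< b b<))) (≮⇒≥ Gb≮m)

      disconnects : ks ≢ replicate m pstar ++ pw m ∷ [] → Disconnects p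
      disconnects ks≢ = by-last-factor y refl
        where
          power? : ∀ k → Dec (∃ λ K′ → k ≡ pw K′)
          power? pstar   = no λ ()
          power? (pw K′) = yes (K′ , refl)
          by-last-factor : ∀ y′ → y ≡ y′ → Disconnects p
          by-last-factor pstar  y≡ = ⊥-elim (last-not-star y≡)
          by-last-factor (pw K) y≡ with search? m (λ j → ∃ λ K′ → factor j ≡ pw K′) (λ j → power? (factor j))
          ... | yes (j , j<m , K′ , factor-j) = power-factor-disconnects j K′ K j<m factor-j y≡
          ... | no  no-power = ⊥-elim (ks≢ (cong₂ (λ u v → u ++ v ∷ []) (all-stars stars) (trans y≡ (cong pw (all-stars-balanced K stars y≡)))))
            where
              stars : ∀ j → j < m → factor j ≡ pstar
              stars j j< with factor j in e
              ... | pstar  = refl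
              ... | pw K′ = ⊥-elim (no-power (j , j< , K′ , e))

      private
        γ = connectedComponents ks p
        γ-RGS = GeneratedPartition.isRGS (components ks p)
        γ-respects : ∀ a b → a < b → b < length E → p ‼ a ≡ p ‼ b → γ ‼ (G ‼ a) ≡ γ ‼ (G ‼ b)
        γ-respects a b a<b b< = Respects-pairsOf⁻ (γ ‼_) p G (trans p-length (sym (length-factorIndices 0 ks)))
                                  (GeneratedPartition.respects (components ks p)) a b a<b (<p b<)

      disconnected : ks ≢ replicate m pstar ++ pw m ∷ [] → γ ≢ onê (length ks)
      disconnected ks≢ γ≡ with disconnects ks≢
      ... | s , s-respects , i , j , i< , j< , si≢sj = si≢sj (GeneratedPartition.finest (components ks p) s
              (Respects-pairsOf⁺ s p G λ a b a<b b< → s-respects a b a<b (subst (b <_) p-length b<)) i j i< j<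
              (trans (cong (_‼ i) γ≡) (trans (at-replicate 0 0 (length ks) i i<) (sym (trans (cong (_‼ j) γ≡) (at-replicate 0 0 (length ks) j j<))))))

      connected : (∀ j → j < m → factor j ≡ pstar) → γ ≡ onê (length ks)
      connected stars = at-ext 0 γ (onê (length ks)) (trans (RGS-length γ-RGS) (sym (ListP.length-replicate (length ks)))) λ k k< →
        trans (γ‼≡0 k (subst (k <_) (trans (RGS-length γ-RGS) ks-length) k<))
              (sym (at-replicate 0 0 (length ks) k (subst (k <_) (RGS-length γ-RGS) k<)))
        where
          joined : ∀ i → i < m → γ ‼ i ≡ γ ‼ m
          joined = joined-to-last stars (γ ‼_) γ-respects
          γ‼0≡0 : γ ‼ 0 ≡ 0
          γ‼0≡0 = RGS-head (subst (λ n → RGS n γ) ks-length γ-RGS)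
          γ‼m≡0 : γ ‼ m ≡ 0
          γ‼m≡0 with m ≟ 0
          ... | yes refl = γ‼0≡0
          ... | no  m≢0  = trans (sym (joined 0 (n≢0⇒n>0 m≢0))) γ‼0≡0
          γ‼≡0 : ∀ k → k < suc m → γ ‼ k ≡ 0
          γ‼≡0 k k< with m<1+n⇒m<n∨m≡n k<
          ... | inj₁ k<m  = trans (joined k k<m) γ‼m≡0
          ... | inj₂ refl = γ‼m≡0

  toList-pattern : ∀ m → toList (Vec.replicate m pstar ∷ʳ pw m) ≡ replicate m pstar ++ pw m ∷ []
  toList-pattern m = trans (VecP.toList-∷ʳ (pw m) (Vec.replicate m pstar)) (cong (_++ pw m ∷ []) (VecP.toList-replicate m pstar))

  split-last : ∀ m (ks : Vec Pow (suc m)) → ks ≢ Vec.replicate m pstar ∷ʳ pw m →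
    ∃ λ ys → ∃ λ y → length ys ≡ m × toList ks ≡ ys ++ y ∷ [] × ys ++ y ∷ [] ≢ replicate m pstar ++ pw m ∷ []
  split-last m ks ks≢ with Vec.initLast ks
  ... | ys , y , refl = toList ys , y , VecP.length-toList ys , toList≡ , λ e → ks≢ $ trans (sym (VecP.cast-is-id refl (ys ∷ʳ y)))
      (VecP.toList-injective refl (ys ∷ʳ y) (Vec.replicate m pstar ∷ʳ pw m) (trans toList≡ (trans e (sym (toList-pattern m)))))
    where
      toList≡ : toList (ys ∷ʳ y) ≡ toList ys ++ y ∷ []
      toList≡ = VecP.toList-∷ʳ y ys

module Cumulants {c ℓ : Level} (R : CommutativeRing c ℓ) (t : List ℕ → CommutativeRing.Carrier R) where

  open Combinatorics
  open import Data.Nat using (ℕ; zero; suc; _≤_; _<_; s≤s; z<s; _≡ᵇ_)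
  import Data.Nat as ℕ
  import Data.Nat.Properties as ℕP
  open import Relation.Binary.PropositionalEquality as P using (_≡_; _≢_)
  open Fock R t
  open CommutativeRing R hiding (_≈_; 0#; 1#; zero)
  open import Relation.Binary.Reasoning.Setoid setoid
  open import Algebra.Properties.CommutativeSemigroup *-commutativeSemigroup using (x∙yz≈y∙xz)
  open import Algebra.Properties.CommutativeSemigroup +-commutativeSemigroup using (interchange)

  [_] : Bool → Carrier
  [ true ]  = 1#
  [ false ] = 0#

  ≡⇒≈ : ∀ {x y} → x ≡ y → x ≈ y
  ≡⇒≈ P.refl = refl

  ind∧ : ∀ a b → [ a ∧ b ] ≈ [ a ] * [ b ]
  ind∧ true  b = sym (*-identityˡ _)
  ind∧ false b = sym (zeroˡ _)

  Σ-cong : {A : Set} (xs : List A) {f g : A → Carrier} → (∀ x → x ∈ xs → f x ≈ g x) → Σ' xs f ≈ Σ' xs g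
  Σ-cong []       _ = refl
  Σ-cong (x ∷ xs) h = +-cong (h x (here P.refl)) (Σ-cong xs (λ y y∈ → h y (there y∈)))

  Σ-zero : {A : Set} (xs : List A) {f : A → Carrier} → (∀ x → x ∈ xs → f x ≈ 0#) → Σ' xs f ≈ 0#
  Σ-zero []       _ = refl
  Σ-zero (x ∷ xs) h = trans (+-cong (h x (here P.refl)) (Σ-zero xs (λ y y∈ → h y (there y∈)))) (+-identityˡ 0#)

  Σ-+ : {A : Set} (xs : List A) (f g : A → Carrier) → Σ' xs (λ x → f x + g x) ≈ Σ' xs f + Σ' xs g
  Σ-+ []       f g = sym (+-identityˡ 0#)
  Σ-+ (x ∷ xs) f g = trans (+-congˡ (Σ-+ xs f g)) (interchange (f x) (g x) (Σ' xs f) (Σ' xs g))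

  Σ-*ˡ : {A : Set} (xs : List A) (a : Carrier) (f : A → Carrier) → Σ' xs (λ x → a * f x) ≈ a * Σ' xs f
  Σ-*ˡ []       a f = sym (zeroʳ a)
  Σ-*ˡ (x ∷ xs) a f = trans (+-congˡ (Σ-*ˡ xs a f)) (sym (distribˡ a (f x) (Σ' xs f)))

  Σ-*ʳ : {A : Set} (xs : List A) (a : Carrier) (f : A → Carrier) → Σ' xs (λ x → f x * a) ≈ Σ' xs f * a
  Σ-*ʳ xs a f = trans (Σ-cong xs (λ x _ → *-comm (f x) a)) (trans (Σ-*ˡ xs a f) (*-comm a _))

  Σ-swap : {A B : Set} (xs : List A) (ys : List B) (f : A → B → Carrier) →
           Σ' xs (λ x → Σ' ys (f x)) ≈ Σ' ys (λ y → Σ' xs (λ x → f x y))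
  Σ-swap []       ys f = sym (Σ-zero ys (λ _ _ → refl))
  Σ-swap (x ∷ xs) ys f = begin
    Σ' ys (f x) + Σ' xs (λ x → Σ' ys (f x)) ≈⟨ +-congˡ (Σ-swap xs ys f) ⟩
    Σ' ys (f x) + Σ' ys (λ y → Σ' xs (λ x → f x y)) ≈⟨ sym (Σ-+ ys (f x) _) ⟩
    Σ' ys (λ y → f x y + Σ' xs (λ x → f x y)) ∎

  Σ-++ : {A : Set} (xs ys : List A) (f : A → Carrier) → Σ' (xs ++ ys) f ≈ Σ' xs f + Σ' ys f
  Σ-++ []       ys f = sym (+-identityˡ _)
  Σ-++ (x ∷ xs) ys f = trans (+-congˡ (Σ-++ xs ys f)) (sym (+-assoc _ _ _))

  Σ-map : {A B : Set} (g : A → B) (xs : List A) (f : B → Carrier) → Σ' (map g xs) f ≈ Σ' xs (λ x → f (g x))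
  Σ-map g []       f = refl
  Σ-map g (x ∷ xs) f = +-congˡ (Σ-map g xs f)

  Σ-concatMap : {A B : Set} (g : A → List B) (xs : List A) (f : B → Carrier) → Σ' (concatMap g xs) f ≈ Σ' xs (λ x → Σ' (g x) f)
  Σ-concatMap g []       f = refl
  Σ-concatMap g (x ∷ xs) f = trans (Σ-++ (g x) (concatMap g xs) f) (+-congˡ (Σ-concatMap g xs f))

  Σ-filter : {A : Set} (b : A → Bool) (xs : List A) (f : A → Carrier) →
             Σ' (filter (λ x → b x Bool.≟ true) xs) f ≈ Σ' xs (λ x → [ b x ] * f x)
  Σ-filter b []       f = refl
  Σ-filter b (x ∷ xs) f with b x
  ... | true  = +-cong (sym (*-identityˡ _)) (Σ-filter b xs f)
  ... | false = trans (Σ-filter b xs f) (sym (trans (+-congʳ (zeroˡ _)) (+-identityˡ _)))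

  Σ-delta-upTo : ∀ k c₀ (f : ℕ → Carrier) → c₀ < k → Σ' (upTo k) (λ c → [ c ≡ᵇ c₀ ] * f c) ≈ f c₀
  Σ-delta-upTo (suc k) zero f _ = begin
    1# * f 0 + Σ' (applyUpTo suc k) (λ c → [ c ≡ᵇ 0 ] * f c)    ≡⟨ P.cong (λ cs → 1# * f 0 + Σ' cs _) (P.sym (ListP.map-upTo suc k)) ⟩
    1# * f 0 + Σ' (map suc (upTo k)) (λ c → [ c ≡ᵇ 0 ] * f c)   ≈⟨ +-cong (*-identityˡ _) (Σ-map suc (upTo k) _) ⟩
    f 0 + Σ' (upTo k) (λ c → 0# * f (suc c))                     ≈⟨ +-congˡ (Σ-zero (upTo k) (λ c _ → zeroˡ _)) ⟩
    f 0 + 0#                                                      ≈⟨ +-identityʳ _ ⟩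
    f 0                                                           ∎
  Σ-delta-upTo (suc k) (suc c₀) f (s≤s c₀<k) = begin
    0# * f 0 + Σ' (applyUpTo suc k) (λ c → [ c ≡ᵇ suc c₀ ] * f c)  ≡⟨ P.cong (λ cs → 0# * f 0 + Σ' cs _) (P.sym (ListP.map-upTo suc k)) ⟩
    0# * f 0 + Σ' (map suc (upTo k)) (λ c → [ c ≡ᵇ suc c₀ ] * f c) ≈⟨ trans (+-congʳ (zeroˡ _)) (+-identityˡ _) ⟩
    Σ' (map suc (upTo k)) (λ c → [ c ≡ᵇ suc c₀ ] * f c)            ≈⟨ Σ-map suc (upTo k) _ ⟩
    Σ' (upTo k) (λ c → [ c ≡ᵇ c₀ ] * f (suc c))                    ≈⟨ Σ-delta-upTo k c₀ (λ c → f (suc c)) c₀<k ⟩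
    f (suc c₀)                                                      ∎

  Σ-delta-RGS : ∀ n π (f : List ℕ → Carrier) → RGS n π → Σ' (allRGS n) (λ τ → [ eqList τ π ] * f τ) ≈ f π
  Σ-delta-RGS zero    .[]               f rnil = trans (+-cong (*-identityˡ _) refl) (+-identityʳ _)
  Σ-delta-RGS (suc n) .(π ++ c₀ ∷ []) f (rsnoc {w = π} {c = c₀} r c₀≤) = begin
    Σ' (allRGS (suc n)) (λ τ → [ eqList τ (π ++ c₀ ∷ []) ] * f τ)              ≈⟨ Σ-concatMap extensions (allRGS n) _ ⟩
    Σ' (allRGS n) (λ w → Σ' (extensions w) (λ τ → [ eqList τ (π ++ c₀ ∷ []) ] * f τ)) ≈⟨ Σ-cong (allRGS n) step ⟩
    Σ' (allRGS n) (λ w → [ eqList w π ] * g w)                                   ≈⟨ Σ-delta-RGS n π g r ⟩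
    g π
      ≈⟨ Σ-delta-upTo (suc (numBlocks π)) c₀ (λ c → f (π ++ c ∷ [])) (s≤s c₀≤) ⟩
    f (π ++ c₀ ∷ [])                                                             ∎
    where
      extensions : List ℕ → List (List ℕ)
      extensions w = map (λ c → w ++ c ∷ []) (upTo (suc (numBlocks w)))
      g : List ℕ → Carrier
      g w = Σ' (upTo (suc (numBlocks w))) (λ c → [ c ≡ᵇ c₀ ] * f (w ++ c ∷ []))
      step : ∀ w → w ∈ allRGS n → Σ' (extensions w) (λ τ → [ eqList τ (π ++ c₀ ∷ []) ] * f τ) ≈ [ eqList w π ] * g w
      step w w∈ = begin
        Σ' (extensions w) (λ τ → [ eqList τ (π ++ c₀ ∷ []) ] * f τ)          ≈⟨ Σ-map _ (upTo (suc (numBlocks w))) _ ⟩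
        Σ' (upTo (suc (numBlocks w))) (λ c → [ eqList (w ++ c ∷ []) (π ++ c₀ ∷ []) ] * f (w ++ c ∷ []))
          ≈⟨ Σ-cong (upTo (suc (numBlocks w))) (λ c _ → trans (*-congʳ (split c)) (*-assoc _ _ _)) ⟩
        Σ' (upTo (suc (numBlocks w))) (λ c → [ eqList w π ] * ([ c ≡ᵇ c₀ ] * f (w ++ c ∷ [])))
          ≈⟨ Σ-*ˡ (upTo (suc (numBlocks w))) _ _ ⟩
        [ eqList w π ] * g w                                                 ∎
        where
          split : ∀ c → [ eqList (w ++ c ∷ []) (π ++ c₀ ∷ []) ] ≈ [ eqList w π ] * [ c ≡ᵇ c₀ ]
          split c = trans (≡⇒≈ (P.cong [_] (eqList-∷ʳ w π c c₀ (P.trans (RGS-length (∈allRGS⇒RGS n w∈)) (P.sym (RGS-length r))))))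
                          (ind∧ (eqList w π) (c ≡ᵇ c₀))

  Σ-delta-seqs : ∀ k m σ₀ (f : List ℕ → Carrier) → length σ₀ ≡ k → (∀ i → i < k → σ₀ ‼ i < m) →
                 Σ' (seqs k m) (λ σ → [ eqList σ σ₀ ] * f σ) ≈ f σ₀
  Σ-delta-seqs zero    m []         f _ _  = trans (+-cong (*-identityˡ _) refl) (+-identityʳ _)
  Σ-delta-seqs (suc k) m (c₀ ∷ σ₀) f e σ₀< = begin
    Σ' (concatMap (λ c → map (c ∷_) (seqs k m)) (upTo m)) (λ σ → [ eqList σ (c₀ ∷ σ₀) ] * f σ)
      ≈⟨ Σ-concatMap _ (upTo m) _ ⟩
    Σ' (upTo m) (λ c → Σ' (map (c ∷_) (seqs k m)) (λ σ → [ eqList σ (c₀ ∷ σ₀) ] * f σ))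
      ≈⟨ Σ-cong (upTo m) (λ c _ → trans (Σ-map _ (seqs k m) _)
           (trans (Σ-cong (seqs k m) (λ σ _ → trans (*-congʳ (ind∧ (c ≡ᵇ c₀) _)) (*-assoc _ _ _))) (Σ-*ˡ (seqs k m) _ _))) ⟩
    Σ' (upTo m) (λ c → [ c ≡ᵇ c₀ ] * Σ' (seqs k m) (λ σ → [ eqList σ σ₀ ] * f (c ∷ σ)))
      ≈⟨ Σ-cong (upTo m) (λ c _ → *-congˡ (Σ-delta-seqs k m σ₀ (λ σ → f (c ∷ σ)) (ℕP.suc-injective e) (λ i i< → σ₀< (suc i) (s≤s i<)))) ⟩
    Σ' (upTo m) (λ c → [ c ≡ᵇ c₀ ] * f (c ∷ σ₀))
      ≈⟨ Σ-delta-upTo m c₀ (λ c → f (c ∷ σ₀)) (σ₀< zero z<s) ⟩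
    f (c₀ ∷ σ₀)                                                                                 ∎

  Π-ind : {A : Set} (xs : List A) (b : A → Bool) → Π' xs (λ x → [ b x ]) ≈ [ allB b xs ]
  Π-ind []       b = refl
  Π-ind (x ∷ xs) b with b x
  ... | true  = trans (*-identityˡ _) (Π-ind xs b)
  ... | false = zeroˡ _

  Π-cong : {A : Set} (xs : List A) {f g : A → Carrier} → (∀ x → f x ≈ g x) → Π' xs f ≈ Π' xs g
  Π-cong []       _ = refl
  Π-cong (x ∷ xs) h = *-cong (h x) (Π-cong xs h)

  Σ-delta-pairRGS : ∀ N π (f : List ℕ → Carrier) → π ∈ pairRGS N → Σ' (pairRGS N) (λ p → [ eqList p π ] * f p) ≈ f π
  Σ-delta-pairRGS N π f π∈ = begin
    Σ' (pairRGS N) (λ p → [ eqList p π ] * f p)                  ≈⟨ Σ-filter isPair (allRGS N) _ ⟩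
    Σ' (allRGS N) (λ p → [ isPair p ] * ([ eqList p π ] * f p))  ≈⟨ Σ-cong (allRGS N) (λ p _ → x∙yz≈y∙xz _ _ _) ⟩
    Σ' (allRGS N) (λ p → [ eqList p π ] * ([ isPair p ] * f p))  ≈⟨ Σ-delta-RGS N π _ (proj₁ (pairRGS⇒ N π∈)) ⟩
    [ isPair π ] * f π                                            ≡⟨ P.cong (λ b → [ b ] * f π) (proj₂ (pairRGS⇒ N π∈)) ⟩
    1# * f π                                                      ≈⟨ *-identityˡ _ ⟩
    f π                                                           ∎

  Σ-delta-perms : ∀ m σ₀ (f : List ℕ → Carrier) → IsPerm m σ₀ → Σ' (perms m) (λ σ → [ eqList σ σ₀ ] * f σ) ≈ f σ₀
  Σ-delta-perms m σ₀ f perm = begin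
    Σ' (perms m) (λ σ → [ eqList σ σ₀ ] * f σ)                   ≈⟨ Σ-filter noDup (seqs m m) _ ⟩
    Σ' (seqs m m) (λ σ → [ noDup σ ] * ([ eqList σ σ₀ ] * f σ))  ≈⟨ Σ-cong (seqs m m) (λ σ _ → x∙yz≈y∙xz _ _ _) ⟩
    Σ' (seqs m m) (λ σ → [ eqList σ σ₀ ] * ([ noDup σ ] * f σ))
      ≈⟨ Σ-delta-seqs m m σ₀ _ (IsPerm.length≡ perm) (IsPerm.bounded perm) ⟩
    [ noDup σ₀ ] * f σ₀                                           ≡⟨ P.cong (λ b → [ b ] * f σ₀) (IsPerm⇒noDup perm) ⟩
    1# * f σ₀                                                     ≈⟨ *-identityˡ _ ⟩
    f σ₀                                                          ∎

  -- Möbius inversion on the refinement order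

  indicator-split : ∀ a b e x → (e ≡ true → (a ∧ b) ≡ true) → [ a ∧ b ] * x ≈ [ a ∧ (b ∧ not e) ] * x + [ e ] * x
  indicator-split a b true  x e⇒ with ∧-elim {a} {b} (e⇒ P.refl)
  ... | P.refl , P.refl = sym (trans (+-congʳ (zeroˡ x)) (+-identityˡ _))
  indicator-split a b false x _ rewrite BoolP.∧-identityʳ b = sym (trans (+-congˡ (zeroˡ x)) (+-identityʳ _))

  indicator-cancel : ∀ a e x → (e ≡ true → a ≡ true) → [ a ∧ not e ] + x ≈ [ a ] → x ≈ [ e ]
  indicator-cancel a true  x e⇒a h rewrite e⇒a P.refl = trans (sym (+-identityˡ x)) h
  indicator-cancel a false x _   h rewrite BoolP.∧-identityʳ a = identityʳ-unique [ a ] x h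
    where open import Algebra.Properties.Group +-group using (identityʳ-unique)

  module Mobius (n : ℕ) where

    private
      Π : List (List ℕ)
      Π = allRGS n

      M : ℕ → List ℕ → List ℕ → Carrier
      M = mobF Π refines eqList

      rgs : ∀ {x} → x ∈ Π → RGS n x
      rgs = ∈allRGS⇒RGS n

      len : ∀ {x} → x ∈ Π → length x ≡ n
      len x∈ = RGS-length (rgs x∈)

      ≤-trans′ : ∀ {x y z} → x ∈ Π → y ∈ Π → z ∈ Π → refines x y ≡ true → refines y z ≡ true → refines x z ≡ true
      ≤-trans′ {x} {y} {z} x∈ y∈ z∈ = refines-trans n {x} {y} {z} (len x∈) (len y∈) (len z∈)

      strictlyBetween : List ℕ → List ℕ → List ℕ → Bool
      strictlyBetween σ π τ = refines σ τ ∧ (refines τ π ∧ not (eqList τ π))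

      strictlyBetween⇒ : ∀ σ π {τ} → τ ∈ filter (λ τ → strictlyBetween σ π τ Bool.≟ true) Π →
                         τ ∈ Π × refines σ τ ≡ true × refines τ π ≡ true × eqList τ π ≡ false
      strictlyBetween⇒ σ π τ∈ with ∈-filter⁻ (λ τ → strictlyBetween σ π τ Bool.≟ true) {xs = Π} τ∈
      ... | τ∈Π , h with ∧-elim h
      ...   | σ≤τ , h′ with ∧-elim h′
      ...     | τ≤π , τ≢π = τ∈Π , σ≤τ , τ≤π , not-true τ≢π

      interval : List ℕ → List ℕ → ℕ
      interval σ π = countB (λ τ → refines σ τ ∧ refines τ π) Π

      interval-shrinks : ∀ {σ τ π} → σ ∈ Π → τ ∈ Π → π ∈ Π → refines σ τ ≡ true → refines τ π ≡ true →
                         eqList τ π ≡ false → interval σ τ < interval σ π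
      interval-shrinks {σ} {τ} {π} σ∈ τ∈ π∈ σ≤τ τ≤π τ≢π = countB-mono-< _ _ Π
          (λ x x∈ h → let σ≤x , x≤τ = ∧-elim h in P.cong₂ _∧_ σ≤x (≤-trans′ x∈ τ∈ π∈ x≤τ τ≤π))
          π π∈ (P.cong₂ _∧_ (≤-trans′ σ∈ τ∈ π∈ σ≤τ τ≤π) (refines-refl π)) π∉
        where
          π∉ : (refines σ π ∧ refines π τ) ≡ false
          π∉ with refines σ π ∧ refines π τ in e
          ... | false = P.refl
          ... | true with refines-antisym (rgs τ∈) (rgs π∈) τ≤π (proj₂ (∧-elim e))
          ...   | P.refl = P.trans (P.sym (eqList-refl τ)) τ≢π

      -- Fuel beyond the length of the longest chain from σ to π does not change the recursion.
      fuel-stable : ∀ f σ π → σ ∈ Π → π ∈ Π → interval σ π ≤ f → M f σ π ≈ M (suc f) σ π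
      fuel-stable zero σ π σ∈ π∈ h with eqList σ π in σ≡π | refines σ π in σ≤π
      ... | true  | _     = ⊥-elim (ℕP.<-irrefl P.refl (ℕP.≤-trans (∈⇒1≤countB _ Π π π∈ (P.cong₂ _∧_ σ≤π′ (refines-refl π))) h))
        where σ≤π′ = P.subst (λ x → refines σ x ≡ true) (eqList⇒≡ σ π σ≡π) (refines-refl σ)
      ... | false | true  = ⊥-elim (ℕP.<-irrefl P.refl (ℕP.≤-trans (∈⇒1≤countB _ Π π π∈ (P.cong₂ _∧_ σ≤π (refines-refl π))) h))
      ... | false | false = refl
      fuel-stable (suc f) σ π σ∈ π∈ h with eqList σ π | refines σ π in σ≤π
      ... | true  | _     = refl
      ... | false | false = refl
      ... | false | true  = -‿cong (Σ-cong (filter _ Π) λ τ τ∈ →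
              let τ∈Π , σ≤τ , τ≤π , τ≢π = strictlyBetween⇒ σ π τ∈
              in fuel-stable f σ τ σ∈ τ∈Π (ℕP.≤-pred (ℕP.<-≤-trans (interval-shrinks σ∈ τ∈Π π∈ σ≤τ τ≤π τ≢π) h)))

      nonempty : ∀ {π} → π ∈ Π → ∃ λ F → length Π ≡ suc F
      nonempty {π} π∈ with Π
      ... | x ∷ xs = length xs , P.refl

    μ-diag : ∀ σ → σ ∈ Π → μ n σ σ ≈ 1#
    μ-diag σ σ∈ with nonempty σ∈
    ... | F , e rewrite e | eqList-refl σ = refl

    μ-rec : ∀ σ π → σ ∈ Π → π ∈ Π → eqList σ π ≡ false → refines σ π ≡ true →
            μ n σ π ≈ - Σ' (filter (λ τ → strictlyBetween σ π τ Bool.≟ true) Π) (μ n σ)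
    μ-rec σ π σ∈ π∈ σ≢π σ≤π with nonempty π∈
    ... | F , e rewrite e | σ≢π | σ≤π = -‿cong (Σ-cong (filter _ Π) λ τ τ∈ →
            let τ∈Π , σ≤τ , τ≤π , τ≢π = strictlyBetween⇒ σ π τ∈
            in fuel-stable F σ τ σ∈ τ∈Π (ℕP.≤-pred (ℕP.<-≤-trans (interval-shrinks σ∈ τ∈Π π∈ σ≤τ τ≤π τ≢π)
                                                               (P.subst (interval σ π ≤_) e (countB≤length _ Π)))))

    Σμ-interval : ∀ σ π → σ ∈ Π → π ∈ Π → Σ' Π (λ τ → [ refines σ τ ∧ refines τ π ] * μ n σ τ) ≈ [ eqList σ π ]
    Σμ-interval σ π σ∈ π∈ with eqList σ π in σ≡π
    ... | true with eqList⇒≡ σ π σ≡π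
    ...   | P.refl = begin
      Σ' Π (λ τ → [ refines σ τ ∧ refines τ σ ] * μ n σ τ)   ≈⟨ Σ-cong Π (λ τ τ∈ → *-congʳ (≡⇒≈ (P.cong [_] (both-ways τ τ∈)))) ⟩
      Σ' Π (λ τ → [ eqList τ σ ] * μ n σ τ)                  ≈⟨ Σ-delta-RGS n σ (μ n σ) (rgs σ∈) ⟩
      μ n σ σ                                                 ≈⟨ μ-diag σ σ∈ ⟩
      1#                                                      ∎
      where
        both-ways : ∀ τ → τ ∈ Π → (refines σ τ ∧ refines τ σ) ≡ eqList τ σ
        both-ways τ τ∈ = bool-ext
          (λ h → ≡⇒eqList (refines-antisym (rgs τ∈) (rgs σ∈) (proj₂ (∧-elim h)) (proj₁ (∧-elim h))))
          (λ h → P.subst (λ x → (refines σ x ∧ refines x σ) ≡ true) (P.sym (eqList⇒≡ τ σ h)) (∧-intro (refines-refl σ) (refines-refl σ)))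
    Σμ-interval σ π σ∈ π∈ | false with refines σ π in σ≤π
    ... | false = Σ-zero Π λ τ τ∈ → P.subst (λ b → [ b ] * μ n σ τ ≈ 0#) (P.sym (outside τ τ∈)) (zeroˡ _)
      where
        outside : ∀ τ → τ ∈ Π → (refines σ τ ∧ refines τ π) ≡ false
        outside τ τ∈ with refines σ τ ∧ refines τ π in h
        ... | false = P.refl
        ... | true  = P.trans (P.sym (≤-trans′ σ∈ τ∈ π∈ (proj₁ (∧-elim h)) (proj₂ (∧-elim h)))) σ≤π
    ... | true = begin
      Σ' Π (λ τ → [ refines σ τ ∧ refines τ π ] * μ n σ τ)
        ≈⟨ Σ-cong Π (λ τ _ → indicator-split (refines σ τ) (refines τ π) (eqList τ π) (μ n σ τ) top) ⟩
      Σ' Π (λ τ → [ strictlyBetween σ π τ ] * μ n σ τ + [ eqList τ π ] * μ n σ τ)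
        ≈⟨ Σ-+ Π _ _ ⟩
      Σ' Π (λ τ → [ strictlyBetween σ π τ ] * μ n σ τ) + Σ' Π (λ τ → [ eqList τ π ] * μ n σ τ)
        ≈⟨ +-cong (sym (Σ-filter (strictlyBetween σ π) Π (μ n σ))) (Σ-delta-RGS n π (μ n σ) (rgs π∈)) ⟩
      S + μ n σ π                                             ≈⟨ +-congˡ (μ-rec σ π σ∈ π∈ σ≡π σ≤π) ⟩
      S + - S                                                 ≈⟨ -‿inverseʳ S ⟩
      0#                                                      ∎
      where
        S = Σ' (filter (λ τ → strictlyBetween σ π τ Bool.≟ true) Π) (μ n σ)
        top : ∀ {τ} → eqList τ π ≡ true → (refines σ τ ∧ refines τ π) ≡ true
        top {τ} τ≡π rewrite eqList⇒≡ τ π τ≡π = ∧-intro σ≤π (refines-refl π)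

    Σμ-upper : List ℕ → List ℕ → Carrier
    Σμ-upper γ π = Σ' Π (λ σ → [ refines γ σ ∧ refines σ π ] * μ n σ π)

    Σ-Σμ-upper : ∀ γ π → π ∈ Π → Σ' Π (λ τ → [ refines τ π ] * Σμ-upper γ τ) ≈ [ refines γ π ]
    Σ-Σμ-upper γ π π∈ = begin
      Σ' Π (λ τ → [ refines τ π ] * Σ' Π (λ σ → [ refines γ σ ∧ refines σ τ ] * μ n σ τ))
        ≈⟨ Σ-cong Π (λ τ _ → sym (Σ-*ˡ Π _ _)) ⟩
      Σ' Π (λ τ → Σ' Π (λ σ → [ refines τ π ] * ([ refines γ σ ∧ refines σ τ ] * μ n σ τ)))
        ≈⟨ Σ-cong Π (λ τ _ → Σ-cong Π (λ σ _ → regroup (refines γ σ) (refines σ τ) (refines τ π) (μ n σ τ))) ⟩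
      Σ' Π (λ τ → Σ' Π (λ σ → [ refines γ σ ] * ([ refines σ τ ∧ refines τ π ] * μ n σ τ)))
        ≈⟨ Σ-swap Π Π _ ⟩
      Σ' Π (λ σ → Σ' Π (λ τ → [ refines γ σ ] * ([ refines σ τ ∧ refines τ π ] * μ n σ τ)))
        ≈⟨ Σ-cong Π (λ σ σ∈ → trans (Σ-*ˡ Π _ _) (*-congˡ (Σμ-interval σ π σ∈ π∈))) ⟩
      Σ' Π (λ σ → [ refines γ σ ] * [ eqList σ π ])          ≈⟨ Σ-cong Π (λ σ _ → *-comm _ _) ⟩
      Σ' Π (λ σ → [ eqList σ π ] * [ refines γ σ ])          ≈⟨ Σ-delta-RGS n π (λ σ → [ refines γ σ ]) (rgs π∈) ⟩
      [ refines γ π ]                                          ∎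
      where
        regroup : ∀ a b c x → [ c ] * ([ a ∧ b ] * x) ≈ [ a ] * ([ b ∧ c ] * x)
        regroup false b     c x = trans (*-congˡ (zeroˡ x)) (trans (zeroʳ _) (sym (zeroˡ _)))
        regroup true  false c x = trans (*-congˡ (zeroˡ x)) (trans (zeroʳ _) (sym (trans (*-identityˡ _) (zeroˡ x))))
        regroup true  true  c x = trans (*-congˡ (*-identityˡ x)) (sym (*-identityˡ _))

    private
      below : List ℕ → ℕ
      below π = countB (λ τ → refines τ π) Π

      below-shrinks : ∀ {τ π} → τ ∈ Π → π ∈ Π → refines τ π ≡ true → eqList τ π ≡ false → below τ < below π
      below-shrinks {τ} {π} τ∈ π∈ τ≤π τ≢π =
        countB-mono-< _ _ Π (λ x x∈ x≤τ → ≤-trans′ x∈ τ∈ π∈ x≤τ τ≤π) π π∈ (refines-refl π) π≰τ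
        where
          π≰τ : refines π τ ≡ false
          π≰τ with refines π τ in π≤τ
          ... | false = P.refl
          ... | true with refines-antisym (rgs τ∈) (rgs π∈) τ≤π π≤τ
          ...   | P.refl = P.trans (P.sym (eqList-refl τ)) τ≢π

      -- Splitting off τ = π in Σ-Σμ-upper leaves the terms below π, which are known by induction.
      Σμ-upper-step : ∀ γ π → γ ∈ Π → π ∈ Π →
        (∀ τ → τ ∈ Π → refines τ π ≡ true → eqList τ π ≡ false → Σμ-upper γ τ ≈ [ eqList τ γ ]) →
        [ refines γ π ∧ not (eqList π γ) ] + Σμ-upper γ π ≈ [ refines γ π ]
      Σμ-upper-step γ π γ∈ π∈ below-π = begin
        [ refines γ π ∧ not (eqList π γ) ] + Σμ-upper γ π
          ≈⟨ +-cong (sym (trans (Σ-delta-RGS n γ _ (rgs γ∈)) (≡⇒≈ (P.cong (λ b → [ refines γ π ∧ not b ]) (eqList-sym γ π)))))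
                    (sym (Σ-delta-RGS n π (Σμ-upper γ) (rgs π∈))) ⟩
        Σ' Π (λ τ → [ eqList τ γ ] * [ refines τ π ∧ not (eqList τ π) ]) + Σ' Π (λ τ → [ eqList τ π ] * Σμ-upper γ τ)
          ≈⟨ +-congʳ (sym (Σ-cong Π strictly-below)) ⟩
        Σ' Π (λ τ → [ refines τ π ∧ not (eqList τ π) ] * Σμ-upper γ τ) + Σ' Π (λ τ → [ eqList τ π ] * Σμ-upper γ τ)
          ≈⟨ sym (Σ-+ Π _ _) ⟩
        Σ' Π (λ τ → [ refines τ π ∧ not (eqList τ π) ] * Σμ-upper γ τ + [ eqList τ π ] * Σμ-upper γ τ)
          ≈⟨ sym (Σ-cong Π (λ τ _ → indicator-split true (refines τ π) (eqList τ π) _ (top τ))) ⟩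
        Σ' Π (λ τ → [ refines τ π ] * Σμ-upper γ τ)
          ≈⟨ Σ-Σμ-upper γ π π∈ ⟩
        [ refines γ π ]                                         ∎
        where
          strictly-below : ∀ τ → τ ∈ Π →
            [ refines τ π ∧ not (eqList τ π) ] * Σμ-upper γ τ ≈ [ eqList τ γ ] * [ refines τ π ∧ not (eqList τ π) ]
          strictly-below τ τ∈ with refines τ π ∧ not (eqList τ π) in τ<π
          ... | false = trans (zeroˡ _) (sym (zeroʳ _))
          ... | true  = trans (*-identityˡ _) (trans (below-π τ τ∈ (proj₁ (∧-elim τ<π)) (not-true (proj₂ (∧-elim τ<π))))
                                                     (sym (*-identityʳ _)))
          top : ∀ τ → eqList τ π ≡ true → refines τ π ≡ true
          top τ τ≡π rewrite eqList⇒≡ τ π τ≡π = refines-refl π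

      Σμ-upper-bounded : ∀ k γ π → γ ∈ Π → π ∈ Π → below π ≤ k → Σμ-upper γ π ≈ [ eqList π γ ]
      Σμ-upper-bounded zero    γ π γ∈ π∈ h =
        ⊥-elim (ℕP.<-irrefl P.refl (ℕP.≤-trans (∈⇒1≤countB _ Π π π∈ (refines-refl π)) h))
      Σμ-upper-bounded (suc k) γ π γ∈ π∈ h = indicator-cancel (refines γ π) (eqList π γ) (Σμ-upper γ π) γ≤π
        (Σμ-upper-step γ π γ∈ π∈ λ τ τ∈ τ≤π τ≢π →
          Σμ-upper-bounded k γ τ γ∈ τ∈ (ℕP.≤-pred (ℕP.<-≤-trans (below-shrinks τ∈ π∈ τ≤π τ≢π) h)))
        where
          γ≤π : eqList π γ ≡ true → refines γ π ≡ true
          γ≤π π≡γ rewrite eqList⇒≡ π γ π≡γ = refines-refl γ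

    Σμ-upper≈δ : ∀ γ π → γ ∈ Π → π ∈ Π → Σμ-upper γ π ≈ [ eqList π γ ]
    Σμ-upper≈δ γ π γ∈ π∈ = Σμ-upper-bounded (below π) γ π γ∈ π∈ ℕP.≤-refl

  private
    contraction : (Eps × ℕ) × (Eps × ℕ) → Carrier
    contraction ((e , c) , (e′ , c′)) = Q e e′ * ip c c′

    contraction≈ : ∀ pr → contraction pr ≈ [ contracts pr ]
    contraction≈ ((e , c) , (e′ , c′)) = trans (*-cong (Q≈ e e′) (ip≈ c c′)) (sym (ind∧ (isStarOne e e′) (c ≡ᵇ c′)))
      where
        Q≈ : ∀ e e′ → Q e e′ ≈ [ isStarOne e e′ ]
        Q≈ star star = refl
        Q≈ star one  = refl
        Q≈ one  star = refl
        Q≈ one  one  = refl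
        ip≈ : ∀ c c′ → ip c c′ ≈ [ c ≡ᵇ c′ ]
        ip≈ c c′ with c ≡ᵇ c′
        ... | true  = refl
        ... | false = refl

  ρ-expansion : (E : List Eps) (G : List ℕ) (col : ℕ → ℕ) → length E ≡ length G →
    ρ (zip E (map col G)) ≈ Σ' (pairRGS (length E)) (λ p → t p * ([ admissible E p ] * [ sameColour col G p ]))
  ρ-expansion E G col E≡G = begin
    ρ w
      ≡⟨ P.cong (λ N → Σ' (pairRGS N) (λ π → t π * Π' (pairsOf (zip π w)) contraction)) w≡E ⟩
    Σ' (pairRGS (length E)) (λ π → t π * Π' (pairsOf (zip π w)) contraction) ≈⟨ Σ-cong (pairRGS (length E)) term ⟩
    Σ' (pairRGS (length E)) (λ p → t p * ([ admissible E p ] * [ sameColour col G p ])) ∎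
    where
      w = zip E (map col G)
      w≡E : length w ≡ length E
      w≡E = length-zip E (map col G) (P.trans E≡G (P.sym (ListP.length-map col G)))
      term : ∀ p → p ∈ pairRGS (length E) → t p * Π' (pairsOf (zip p w)) contraction ≈ t p * ([ admissible E p ] * [ sameColour col G p ])
      term p p∈ = *-congˡ (begin
        Π' (pairsOf (zip p w)) contraction                   ≈⟨ Π-cong (pairsOf (zip p w)) contraction≈ ⟩
        Π' (pairsOf (zip p w)) (λ x → [ contracts x ])       ≈⟨ Π-ind (pairsOf (zip p w)) contracts ⟩
        [ allB contracts (pairsOf (zip p w)) ]
          ≡⟨ P.cong [_] (allB-contracts E G col p E≡G (RGS-length (proj₁ (pairRGS⇒ (length E) p∈)))) ⟩
        [ admissible E p ∧ sameColour col G p ]              ≈⟨ ind∧ (admissible E p) _ ⟩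
        [ admissible E p ] * [ sameColour col G p ]          ∎)

  ρσ-expansion : ∀ σ ks → length σ ≡ length ks →
    ρσ σ ks ≈ Σ' (pairRGS (length (letters ks))) (λ p → t p * ([ admissible (letters ks) p ] * [ sameColour (λ g → suc (σ ‼ g)) (factorOf ks) p ]))
  ρσ-expansion σ ks e = trans (≡⇒≈ (P.cong ρ (colour-factors (σ ‼_) σ ks 0 e (λ i → P.refl))))
                              (ρ-expansion (letters ks) (factorOf ks) (λ g → suc (σ ‼ g)) (P.sym (length-factorIndices 0 ks)))

  -- Cumulants as sums over connected admissible pairings

  Kπ-connected : ∀ π ks → π ∈ allRGS (length ks) →
    Kπ π ks ≈ Σ' (pairRGS (length (letters ks))) (λ p → t p * ([ admissible (letters ks) p ] * [ eqList π (connectedComponents ks p) ]))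
  Kπ-connected π ks π∈ = begin
    Kπ π ks
      ≈⟨ Σ-filter (λ σ → refines σ π) Partitions _ ⟩
    Σ' Partitions (λ σ → [ refines σ π ] * (ρσ σ ks * μ n σ π))
      ≈⟨ Σ-cong Partitions (λ σ σ∈ → *-congˡ (*-congʳ (ρσ-expansion σ ks (RGS-length (∈allRGS⇒RGS n σ∈))))) ⟩
    Σ' Partitions (λ σ → [ refines σ π ] * (Σ' Pairings (λ p → weight p σ) * μ n σ π))
      ≈⟨ Σ-cong Partitions (λ σ _ → trans (*-congˡ (sym (Σ-*ʳ Pairings _ _))) (sym (Σ-*ˡ Pairings _ _))) ⟩
    Σ' Partitions (λ σ → Σ' Pairings (λ p → [ refines σ π ] * (weight p σ * μ n σ π)))
      ≈⟨ Σ-swap Partitions Pairings _ ⟩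
    Σ' Pairings (λ p → Σ' Partitions (λ σ → [ refines σ π ] * (weight p σ * μ n σ π)))
      ≈⟨ Σ-cong Pairings (λ p _ → per-pairing p) ⟩
    Σ' Pairings (λ p → t p * ([ admissible E p ] * [ eqList π (connectedComponents ks p) ])) ∎
    where
      open import Algebra.Solver.CommutativeMonoid *-commutativeMonoid using (solve; _⊜_; _⊕_)
      n = length ks
      E = letters ks
      Partitions = allRGS n
      Pairings = pairRGS (length E)
      weight : List ℕ → List ℕ → Carrier
      weight p σ = t p * ([ admissible E p ] * [ sameColour (λ g → suc (σ ‼ g)) (factorOf ks) p ])
      rearrange : ∀ r T a c x → r * ((T * (a * c)) * x) ≈ T * (a * ((c * r) * x))
      rearrange = solve 5 (λ r T a c x → r ⊕ ((T ⊕ (a ⊕ c)) ⊕ x) ⊜ T ⊕ (a ⊕ ((c ⊕ r) ⊕ x))) refl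
      per-pairing : ∀ p → Σ' Partitions (λ σ → [ refines σ π ] * (weight p σ * μ n σ π)) ≈
                          t p * ([ admissible E p ] * [ eqList π (connectedComponents ks p) ])
      per-pairing p = begin
        Σ' Partitions (λ σ → [ refines σ π ] * (weight p σ * μ n σ π))
          ≈⟨ Σ-cong Partitions (λ σ σ∈ → trans (rearrange _ _ _ _ _) (*-congˡ (*-congˡ (*-congʳ (trans
               (≡⇒≈ (P.cong (λ b → [ b ] * [ refines σ π ]) (sameColour≡refines ks p σ (RGS-length (∈allRGS⇒RGS n σ∈)))))
               (sym (ind∧ (refines (connectedComponents ks p) σ) (refines σ π)))))))) ⟩
        Σ' Partitions (λ σ → t p * ([ admissible E p ] * ([ refines γ σ ∧ refines σ π ] * μ n σ π)))
          ≈⟨ trans (Σ-*ˡ Partitions _ _) (*-congˡ (Σ-*ˡ Partitions _ _)) ⟩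
        t p * ([ admissible E p ] * Mobius.Σμ-upper n γ π)
          ≈⟨ *-congˡ (*-congˡ (Mobius.Σμ-upper≈δ n γ π (RGS⇒∈allRGS (GeneratedPartition.isRGS (components ks p))) π∈)) ⟩
        t p * ([ admissible E p ] * [ eqList π γ ]) ∎
        where γ = connectedComponents ks p

  K-connected : ∀ ks → K ks ≈ Σ' (pairRGS (length (letters ks)))
    (λ p → t p * ([ admissible (letters ks) p ] * [ eqList (onê (length ks)) (connectedComponents ks p) ]))
  K-connected ks = Kπ-connected (onê (length ks)) ks (RGS⇒∈allRGS (RGS-onê (length ks)))

  K-vanishes : ∀ ys y m → length ys ≡ m → ys ++ y ∷ [] ≢ replicate m pstar ++ pw m ∷ [] → K (ys ++ y ∷ []) ≈ 0#
  K-vanishes ys y m ys-length ks≢ = trans (K-connected ks) (Σ-zero (pairRGS (length E)) term)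
    where
      open Disconnection ys y m ys-length
      term : ∀ p → p ∈ pairRGS (length E) → t p * ([ admissible E p ] * [ eqList (onê (length ks)) (connectedComponents ks p) ]) ≈ 0#
      term p p∈ with admissible E p in adm
      ... | false = trans (*-congˡ (zeroˡ _)) (zeroʳ _)
      ... | true  = trans (*-congˡ (*-congˡ (≡⇒≈ (P.cong [_] (≢⇒eqList-false _ _ λ e → disconnected p p-length pair
                      (admissible⇒Admissible E p p-length adm) ks≢ (P.sym e)))))) (trans (*-congˡ (zeroʳ _)) (zeroʳ _))
        where
          p-length = RGS-length (proj₁ (pairRGS⇒ (length E) p∈))
          pair = proj₂ (pairRGS⇒ (length E) p∈)

  ρH-expansion : ∀ E → ρH E ≈ Σ' (pairRGS (length E)) (λ p → t p * [ admissible E p ])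
  ρH-expansion E = begin
    ρ (map (λ e → e , 1) E)
      ≡⟨ P.cong ρ (P.trans (map-pair-replicate E 1) (P.cong (zip E) (P.sym (ListP.map-replicate (λ _ → 1) (length E) 0)))) ⟩
    ρ (zip E (map (λ _ → 1) Z))
      ≈⟨ ρ-expansion E Z (λ _ → 1) (P.sym (ListP.length-replicate (length E))) ⟩
    Σ' (pairRGS (length E)) (λ p → t p * ([ admissible E p ] * [ sameColour (λ _ → 1) Z p ]))
      ≈⟨ Σ-cong (pairRGS (length E)) (λ p _ → *-congˡ (trans (*-congˡ (≡⇒≈ (P.cong [_] (allB-const (pairsOf (zip p Z)))))) (*-identityʳ _))) ⟩
    Σ' (pairRGS (length E)) (λ p → t p * [ admissible E p ]) ∎
    where Z = replicate (length E) 0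

  letters-pattern : ∀ m → letters (replicate m pstar ++ pw m ∷ []) ≡ replicate m star ++ replicate m one
  letters-pattern m = P.trans (letters-stars m (pw m ∷ [])) (P.cong (replicate m star ++_) (ListP.++-identityʳ (replicate m one)))

  K-pattern : ∀ m → K (replicate m pstar ++ pw m ∷ []) ≈ ρH (replicate m star ++ replicate m one)
  K-pattern m = begin
    K ks                                                     ≈⟨ K-connected ks ⟩
    Σ' (pairRGS (length E)) (λ p → t p * ([ admissible E p ] * [ eqList (onê (length ks)) (connectedComponents ks p) ]))
                                                             ≈⟨ Σ-cong (pairRGS (length E)) term ⟩
    Σ' (pairRGS (length E)) (λ p → t p * [ admissible E p ]) ≈⟨ sym (ρH-expansion E) ⟩
    ρH E                                                     ≡⟨ P.cong ρH (letters-pattern m) ⟩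
    ρH (replicate m star ++ replicate m one)                 ∎
    where
      open Disconnection (replicate m pstar) (pw m) m (ListP.length-replicate m)
      stars : ∀ j → j < m → factor j ≡ pstar
      stars j j< = P.trans (factor-< j j<) (at-replicate (pw 0) pstar m j j<)
      term : ∀ p → p ∈ pairRGS (length E) →
             t p * ([ admissible E p ] * [ eqList (onê (length ks)) (connectedComponents ks p) ]) ≈ t p * [ admissible E p ]
      term p p∈ with admissible E p in adm
      ... | false = *-congˡ (zeroˡ _)
      ... | true  = *-congˡ (trans (*-congˡ (≡⇒≈ (P.cong [_] (≡⇒eqList (P.sym (connected p p-length pair adm′ stars))))))
                                   (*-identityʳ _))
        where
          p-length = RGS-length (proj₁ (pairRGS⇒ (length E) p∈))
          pair = proj₂ (pairRGS⇒ (length E) p∈)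
          adm′ = admissible⇒Admissible E p p-length adm

  Kπ-singletons : ∀ ks → All (λ k → length (word k) ≡ 1) ks → ∀ π → π ∈ pairRGS (length (letters ks)) →
                  Kπ π ks ≈ t π * [ admissible (letters ks) π ]
  Kπ-singletons ks singles π π∈ = begin
    Kπ π ks
      ≈⟨ Kπ-connected π ks (RGS⇒∈allRGS (to-ks (proj₁ (pairRGS⇒ N π∈)))) ⟩
    Σ' (pairRGS N) (λ p → t p * ([ admissible E p ] * [ eqList π (connectedComponents ks p) ]))
      ≈⟨ Σ-cong (pairRGS N) (λ p p∈ → trans (≡⇒≈ (P.cong (λ γ → t p * ([ admissible E p ] * [ eqList π γ ]))
                                                      (connectedComponents-singletons ks p singles (to-ks (proj₁ (pairRGS⇒ N p∈))))))
                                             (regroup p)) ⟩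
    Σ' (pairRGS N) (λ p → [ eqList p π ] * (t p * [ admissible E p ]))
      ≈⟨ Σ-delta-pairRGS N π _ π∈ ⟩
    t π * [ admissible E π ] ∎
    where
      open import Algebra.Properties.CommutativeSemigroup *-commutativeSemigroup using (x∙yz≈z∙xy)
      E = letters ks
      N = length E
      to-ks : ∀ {p} → RGS N p → RGS (length ks) p
      to-ks {p} = P.subst (λ n → RGS n p) (length-letters-singletons ks singles)
      regroup : ∀ p → t p * ([ admissible E p ] * [ eqList π p ]) ≈ [ eqList p π ] * (t p * [ admissible E p ])
      regroup p = trans (x∙yz≈z∙xy _ _ _) (*-congʳ (≡⇒≈ (P.cong [_] (eqList-sym π p))))

  Σ-perms-piSigma : ∀ m π → π ∈ allRGS (m ℕ.+ m) →
    Σ' (perms m) (λ σ → [ eqList π (piSigma m σ) ]) ≈ [ isPair π ∧ admissible (starsOnes m m) π ]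
  Σ-perms-piSigma m π π∈ = by-cases (isPair π) (admissible E π) P.refl P.refl
    where
      E = starsOnes m m
      π-length : length π ≡ length E
      π-length = P.trans (RGS-length (∈allRGS⇒RGS (m ℕ.+ m) π∈)) (P.sym (length-starsOnes m m))
      unique-preimage : (∃ λ σ₀ → IsPerm m σ₀ × π ≡ piSigma m σ₀) → Σ' (perms m) (λ σ → [ eqList π (piSigma m σ) ]) ≈ 1#
      unique-preimage (σ₀ , perm₀ , π≡) = begin
        Σ' (perms m) (λ σ → [ eqList π (piSigma m σ) ])
          ≈⟨ Σ-cong (perms m) (λ σ σ∈ → trans (≡⇒≈ (P.cong [_] (same-pairing σ σ∈))) (sym (*-identityʳ _))) ⟩
        Σ' (perms m) (λ σ → [ eqList σ σ₀ ] * 1#)       ≈⟨ Σ-delta-perms m σ₀ (λ _ → 1#) perm₀ ⟩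
        1#                                               ∎
        where
          same-pairing : ∀ σ → σ ∈ perms m → eqList π (piSigma m σ) ≡ eqList σ σ₀
          same-pairing σ σ∈ = bool-ext
            (λ h → ≡⇒eqList (P.sym (piSigma-injective perm₀ (∈-perms⁻ m σ∈) (P.trans (P.sym π≡) (eqList⇒≡ π (piSigma m σ) h)))))
            (λ h → ≡⇒eqList (P.trans π≡ (P.cong (piSigma m) (P.sym (eqList⇒≡ σ σ₀ h)))))
      no-preimage : (∀ σ → σ ∈ perms m → π ≢ piSigma m σ) → Σ' (perms m) (λ σ → [ eqList π (piSigma m σ) ]) ≈ 0#
      no-preimage none = Σ-zero (perms m) λ σ σ∈ → ≡⇒≈ (P.cong [_] (≢⇒eqList-false _ _ (none σ σ∈)))
      by-cases : ∀ a b → isPair π ≡ a → admissible E π ≡ b → Σ' (perms m) (λ σ → [ eqList π (piSigma m σ) ]) ≈ [ a ∧ b ]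
      by-cases true  true  pair adm = unique-preimage (crossing-pairing⇒piSigma m π (∈allRGS⇒RGS (m ℕ.+ m) π∈) pair
                                        (Admissible⇒CrossesMiddle m π (admissible⇒Admissible E π π-length adm)))
      by-cases false _     pair _   = no-preimage λ σ σ∈ π≡ → false≢true
        (P.trans (P.sym pair) (P.subst (λ x → isPair x ≡ true) (P.sym π≡) (proj₁ (piSigma-admissible (∈-perms⁻ m σ∈)))))
      by-cases true  false _    adm = no-preimage λ σ σ∈ π≡ → false≢true
        (P.trans (P.sym adm) (P.subst (λ x → admissible E x ≡ true) (P.sym π≡) (proj₂ (piSigma-admissible (∈-perms⁻ m σ∈)))))

  admissible-pairings≈perms : ∀ m → Σ' (pairRGS (m ℕ.+ m)) (λ π → t π * [ admissible (starsOnes m m) π ]) ≈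
                                    Σ' (perms m) (λ σ → t (piSigma m σ))
  admissible-pairings≈perms m = begin
    Σ' (pairRGS N) (λ π → t π * [ admissible E π ])
      ≈⟨ Σ-filter isPair (allRGS N) _ ⟩
    Σ' (allRGS N) (λ π → [ isPair π ] * (t π * [ admissible E π ]))
      ≈⟨ Σ-cong (allRGS N) (λ π π∈ → trans (regroup (isPair π) (admissible E π) (t π)) (*-congʳ (sym (Σ-perms-piSigma m π π∈)))) ⟩
    Σ' (allRGS N) (λ π → Σ' (perms m) (λ σ → [ eqList π (piSigma m σ) ]) * t π)
      ≈⟨ Σ-cong (allRGS N) (λ π _ → sym (Σ-*ʳ (perms m) (t π) _)) ⟩
    Σ' (allRGS N) (λ π → Σ' (perms m) (λ σ → [ eqList π (piSigma m σ) ] * t π))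
      ≈⟨ Σ-swap (allRGS N) (perms m) _ ⟩
    Σ' (perms m) (λ σ → Σ' (allRGS N) (λ π → [ eqList π (piSigma m σ) ] * t π))
      ≈⟨ Σ-cong (perms m) (λ σ σ∈ → Σ-delta-RGS N (piSigma m σ) t (proj₁ (piSigma-crossing-pairing (∈-perms⁻ m σ∈)))) ⟩
    Σ' (perms m) (λ σ → t (piSigma m σ)) ∎
    where
      N = m ℕ.+ m
      E = starsOnes m m
      regroup : ∀ a b x → [ a ] * (x * [ b ]) ≈ [ a ∧ b ] * x
      regroup true  b x = trans (*-identityˡ _) (*-comm _ _)
      regroup false b x = trans (zeroˡ _) (sym (zeroˡ _))

  module _ (m : ℕ) where
    private
      ks : List Pow
      ks = replicate m pstar ++ replicate m (pw 1)
      N≡ : length (letters ks) ≡ m ℕ.+ m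
      N≡ = P.trans (P.cong length (letters-pairing-pattern m)) (length-starsOnes m m)
      Σ-admissible-pattern : Σ' (pairRGS (length (letters ks))) (λ p → t p * [ admissible (letters ks) p ]) ≡
                             Σ' (pairRGS (m ℕ.+ m)) (λ p → t p * [ admissible (starsOnes m m) p ])
      Σ-admissible-pattern = P.trans (P.cong (λ E → Σ' (pairRGS (length E)) (λ p → t p * [ admissible E p ])) (letters-pairing-pattern m))
                                     (P.cong (λ N → Σ' (pairRGS N) (λ p → t p * [ admissible (starsOnes m m) p ])) (length-starsOnes m m))
      ΣKπ≈Σ-admissible : Σ' (pairRGS (m ℕ.+ m)) (λ π → Kπ π ks) ≈ Σ' (pairRGS (m ℕ.+ m)) (λ p → t p * [ admissible (starsOnes m m) p ])
      ΣKπ≈Σ-admissible = begin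
        Σ' (pairRGS (m ℕ.+ m)) (λ π → Kπ π ks)                         ≡⟨ P.cong (λ N → Σ' (pairRGS N) (λ π → Kπ π ks)) (P.sym N≡) ⟩
        Σ' (pairRGS (length (letters ks))) (λ π → Kπ π ks)
          ≈⟨ Σ-cong (pairRGS (length (letters ks))) (Kπ-singletons ks (singletons-pattern m)) ⟩
        Σ' (pairRGS (length (letters ks))) (λ p → t p * [ admissible (letters ks) p ]) ≡⟨ Σ-admissible-pattern ⟩
        Σ' (pairRGS (m ℕ.+ m)) (λ p → t p * [ admissible (starsOnes m m) p ]) ∎

    ρH≈ΣKπ : ρH (replicate m star ++ replicate m one) ≈ Σ' (pairRGS (m ℕ.+ m)) (λ π → Kπ π (replicate m pstar ++ replicate m (pw 1)))
    ρH≈ΣKπ = begin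
      ρH (starsOnes m m)                                                          ≈⟨ ρH-expansion (starsOnes m m) ⟩
      Σ' (pairRGS (length (starsOnes m m))) (λ p → t p * [ admissible (starsOnes m m) p ])
        ≡⟨ P.cong (λ N → Σ' (pairRGS N) (λ p → t p * [ admissible (starsOnes m m) p ])) (length-starsOnes m m) ⟩
      Σ' (pairRGS (m ℕ.+ m)) (λ p → t p * [ admissible (starsOnes m m) p ])      ≈⟨ sym ΣKπ≈Σ-admissible ⟩
      Σ' (pairRGS (m ℕ.+ m)) (λ π → Kπ π ks)                                      ∎

    ΣKπ≈Σt : Σ' (pairRGS (m ℕ.+ m)) (λ π → Kπ π (replicate m pstar ++ replicate m (pw 1))) ≈ Σ' (perms m) (λ σ → t (piSigma m σ))
    ΣKπ≈Σt = trans ΣKπ≈Σ-admissible (admissible-pairings≈perms m)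


-- Opened only here, since ℕ's _+_ would clash with the ring's _+_ inside Cumulants.
open import Data.Nat using (_+_)
open import Relation.Binary.PropositionalEquality using (_≢_; cong)

mainTheorem5 : {c ℓ : Level} (R : CommutativeRing c ℓ)
    (t : List ℕ → CommutativeRing.Carrier R) →
    let open Fock R t
    in t [] ≈ 1# →
       ((m : ℕ) (ks : Vec Pow (suc m)) →
          ks ≢ (Vec.replicate m pstar ∷ʳ pw m) → K (toList ks) ≈ 0#)
       × ((m : ℕ) →
          (K (toList (Vec.replicate m pstar ∷ʳ pw m))
             ≈ ρH (replicate m star ++ replicate m one))
          × (ρH (replicate m star ++ replicate m one)
             ≈ Σ' (pairRGS (m + m)) (λ π → Kπ π (replicate m pstar ++ replicate m (pw 1))))
          × (Σ' (pairRGS (m + m)) (λ π → Kπ π (replicate m pstar ++ replicate m (pw 1)))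
             ≈ Σ' (perms m) (λ σ → t (piSigma m σ))))
mainTheorem5 R t _ = vanishing , λ m → K-on-pattern m , ρH≈ΣKπ m , ΣKπ≈Σt m
  where
    open Fock R t
    open Cumulants R t
    open Combinatorics using (toList-pattern; split-last)
    open CommutativeRing R using (trans; reflexive)
    vanishing : (m : ℕ) (ks : Vec Pow (suc m)) → ks ≢ Vec.replicate m pstar ∷ʳ pw m → K (toList ks) ≈ 0#
    vanishing m ks ks≢ with split-last m ks ks≢
    ... | ys , y , ys-length , ks≡ , ys≢ = trans (reflexive (cong K ks≡)) (K-vanishes ys y m ys-length ys≢)
    K-on-pattern : ∀ m → K (toList (Vec.replicate m pstar ∷ʳ pw m)) ≈ ρH (replicate m star ++ replicate m one)
    K-on-pattern m = trans (reflexive (cong K (toList-pattern m))) (K-pattern m)
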